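{- For integers $r,s\geq 0$ let $a(r,s)=\frac{k(r,r+s)}{r!\,s!}-1$. Then $a(r,0)=a(0,s)=0$ for all $r,s\geq 0$, and for all $r,s\geq 1$, \[a(r,s)=a(r,s-1)+a(r-1,s)-a(r-1,s-1)+\binom{r+s-2}{r-1}\frac{1}{r!\,s!}.\]
   Context: Let $\mathfrak{S}_n$ be the group of permutations of $\{1,\dots,n\}$ in one-line notation. A permutation $w\in\mathfrak{S}_n$ contains the split pattern $3|12$ with respect to position $r$ if there are indices $i_1\leq r<i_2<i_3$ with $w(i_2)<w(i_3)<w(i_1)$; it contains $23|1$ with respect to position $r$ if there are indices $i_1<i_2\leq r<i_3$ with $w(i_3)<w(i_1)<w(i_2)$. $k(r,n)$ is the number of $w\in\mathfrak{S}_n$ avoiding both patterns with respect to position $r$, with the convention $k(0,0)=1$. -}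

module Defs where

open import Data.Bool using (Bool; true; false; _∧_; _∨_; if_then_else_)
open import Data.Nat using (ℕ; zero; suc; _+_; _*_; _<ᵇ_; _≡ᵇ_; _!)
open import Data.Nat.Properties using (_≟_; _!*_!≢0)
open import Data.List using (List; []; _∷_; map; concatMap; upTo; filter; length)
open import Data.Bool.ListAction using (any)
open import Data.List.Relation.Unary.Unique.DecPropositional _≟_ using (unique?)
open import Data.Integer using (+_)
open import Data.Rational using (ℚ; _/_; _-_; 1ℚ)

-- A permutation of {1,…,n} in one-line notation is represented as the list
-- [w(1)-1, …, w(n)-1] : a duplicate-free list of length n with entries in {0,…,n-1}.
-- (Shifting all values by one does not affect pattern containment.)

words : ℕ → ℕ → List (List ℕ)
words m zero    = [] ∷ []
words m (suc l) = concatMap (λ x → map (x ∷_) (words m l)) (upTo m)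

perms : ℕ → List (List ℕ)
perms n = filter unique? (words n n)

-- w(i+1) (0-based lookup, default 0 out of range; only used in range)
at : List ℕ → ℕ → ℕ
at []      _       = 0
at (x ∷ _) zero    = x
at (_ ∷ w) (suc i) = at w i

_≤ᵇ'_ : ℕ → ℕ → Bool
a ≤ᵇ' b = a <ᵇ suc b

-- w contains 3|12 w.r.t. r : ∃ i1 ≤ r < i2 < i3 (1-based) with w(i2) < w(i3) < w(i1).
-- Here j = i - 1 are 0-based indices in {0,…,n-1}.
contains3|12 : ℕ → List ℕ → Bool
contains3|12 r w = any (λ j1 → any (λ j2 → any (λ j3 →
    (j1 <ᵇ r) ∧ (r ≤ᵇ' j2) ∧ (j2 <ᵇ j3) ∧
    (at w j2 <ᵇ at w j3) ∧ (at w j3 <ᵇ at w j1)) (upTo n)) (upTo n)) (upTo n)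
  where n = length w

-- w contains 23|1 w.r.t. r : ∃ i1 < i2 ≤ r < i3 (1-based) with w(i3) < w(i1) < w(i2).
contains23|1 : ℕ → List ℕ → Bool
contains23|1 r w = any (λ j1 → any (λ j2 → any (λ j3 →
    (j1 <ᵇ j2) ∧ (j2 <ᵇ r) ∧ (r ≤ᵇ' j3) ∧
    (at w j3 <ᵇ at w j1) ∧ (at w j1 <ᵇ at w j2)) (upTo n)) (upTo n)) (upTo n)
  where n = length w

avoids : ℕ → List ℕ → Bool
avoids r w = if contains3|12 r w ∨ contains23|1 r w then false else true

k : ℕ → ℕ → ℕ
k r n = length (filter (λ w → Data.Bool._≟_ (avoids r w) true) (perms n))

a : ℕ → ℕ → ℚ
a r s = ((+ k r (r + s)) / (r ! * s !)) {{r !* s !≢0}} - 1ℚ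

module Submission where

-- Write K(r, s) = k(r, r + s) and sort the avoiders of length r + s by where their maximum and their
-- minimum lie relative to the split. A maximum in the right block and a minimum in the left block take
-- part in no occurrence, so removing it leaves an avoider and it can be put back at any position of its
-- block: s K(r, s - 1) avoiders have the maximum on the right, r K(r - 1, s) the minimum on the left,
-- and r s K(r - 1, s - 1) both. If the maximum is on the left and the minimum on the right, the maximum
-- comes first and the rest must be decreasing on both blocks with the minimum on the right; counting
-- these by the position of their maximum gives Pascal's rule, hence binom(r + s - 2, r - 1) of them.
-- Inclusion-exclusion gives K(r, s) = s K(r, s - 1) + r K(r - 1, s) - r s K(r - 1, s - 1)
-- + binom(r + s - 2, r - 1), which divided by r! s! is the recurrence for a; and K(r, 0) = r!,
-- K(0, s) = s!, since no occurrence fits when a block is empty.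

open import Defs

module Combinatorics where

  open import Data.Bool using (Bool; true; false; T)
  import Data.Bool as Bool
  open import Data.Bool.ListAction using (any)
  open import Data.Bool.Properties using (T-∧)
  open import Data.Empty using (⊥-elim)
  open import Data.List
    using (List; []; _∷_; length; map; upTo; filter; concatMap; cartesianProductWith; cartesianProduct; _++_)
  open import Data.List.Membership.Propositional using (_∈_; _∉_)
  open import Data.List.Membership.Propositional.Properties
    using (∈-map⁺; ∈-map⁻; ∈-upTo⁺; ∈-upTo⁻; ∈-filter⁺; ∈-filter⁻; ∈-cartesianProduct⁺; ∈-cartesianProduct⁻;
           ∈-cartesianProductWith⁺; ∈-cartesianProductWith⁻)
  open import Data.List.Membership.Propositional.Properties.WithK using (unique∧set⇒bag)
  open import Data.List.Properties
    using (length-map; length-++; length-upTo; map-∘; map-id; map-cong; map-id-local; ∷-injective;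
           filter-≐; filter-all; filter-none)
  open import Data.List.Relation.Binary.BagAndSetEquality using (∼bag⇒↭)
  open import Data.List.Relation.Binary.Permutation.Propositional
    using (_↭_; ↭-refl; ↭-prep; ↭-swap; ↭-trans; ↭-sym; ↭⇒↭ₛ)
  open import Data.List.Relation.Binary.Permutation.Propositional.Properties
    using (∈-resp-↭; All-resp-↭; ↭-length)
  open import Data.List.Relation.Binary.Subset.Propositional using (_⊆_)
  open import Data.List.Relation.Unary.All using (All; []; _∷_)
  import Data.List.Relation.Unary.All as All
  open import Data.List.Relation.Unary.All.Properties using (¬Any⇒All¬) renaming (map⁺ to All-map⁺)
  open import Data.List.Relation.Unary.Any using (here; there)
  open import Data.List.Relation.Unary.Any.Properties using (any⁺; any⁻; applyUpTo⁺; applyUpTo⁻)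
  open import Data.List.Relation.Unary.Unique.Propositional using (Unique; []; _∷_)
  import Data.List.Relation.Unary.Unique.Propositional.Properties as Unique
  open import Data.Nat using (ℕ; zero; suc; pred; _+_; _*_; _∸_; _≤_; _<_; z≤n; s≤s; _<ᵇ_; _!)
  open import Data.Nat.Combinatorics using (_C_; nCn≡1; nCk+nC[k+1]≡[n+1]C[k+1])
  open import Data.Nat.Properties
    using (_≟_; _≤?_; _<?_; <-cmp; allUpTo?; ≤-refl; ≤-reflexive; ≤-antisym; ≤-pred; ≤-trans; <-trans;
           <-≤-trans; ≤-<-trans; <-irrefl; <⇒≤; ≮⇒≥; <⇒≱; ≰⇒>; ≤∧≢⇒<; <ᵇ⇒<; <⇒<ᵇ; n≮0; 1+n≰n; n≢0⇒n>0;
           suc-injective; m≤m+n; +-comm; +-suc; +-identityʳ; +-monoʳ-≤; +-monoʳ-<; +-cancelˡ-<;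
           m+n∸m≡n; m+[n∸m]≡n)
  open import Data.Nat.Solver using (module +-*-Solver)
  open import Data.Product using (_×_; _,_; proj₁; proj₂; ∃)
  open import Data.Product.Function.NonDependent.Propositional using (_×-⇔_)
  open import Data.Sum using (_⊎_; inj₁; inj₂)
  import Data.Sum as Sum
  open import Function.Base using (_∘_; id)
  open import Function.Bundles using (_⇔_; mk⇔; Equivalence)
  open import Function.Properties.Equivalence using () renaming (trans to ⇔-trans; sym to ⇔-sym)
  open import Function.Related.TypeIsomorphisms using (¬-cong-⇔)
  open import Level using (0ℓ)
  open import Relation.Binary.Definitions using (tri<; tri≈; tri>)
  open import Relation.Binary.PropositionalEquality
    using (_≡_; _≢_; refl; cong; cong₂; sym; trans; subst; subst₂; setoid; module ≡-Reasoning)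
  open import Relation.Nullary using (¬_; yes; no; _⊎-dec_; _→-dec_)
  open import Relation.Unary using (Pred; Decidable; _≐_; U)
  open import Relation.Unary.Properties using (_∩?_; ∁?; U?)

  open import Data.List.Membership.DecPropositional _≟_ using (_∈?_)
  open import Data.List.Relation.Binary.Permutation.Setoid.Properties (setoid ℕ) using (Unique-resp-↭)
  open import Data.List.Relation.Unary.Unique.DecPropositional _≟_ using (unique?)

  open Equivalence using (to; from)

  punchIn : ℕ → ℕ → ℕ
  punchIn zero    j       = suc j
  punchIn (suc i) zero    = zero
  punchIn (suc i) (suc j) = suc (punchIn i j)

  punchOut : ℕ → ℕ → ℕ
  punchOut zero    j       = pred j
  punchOut (suc i) zero    = zero
  punchOut (suc i) (suc j) = suc (punchOut i j)

  punchIn≢ : ∀ i j → punchIn i j ≢ i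
  punchIn≢ (suc i) (suc j) eq = punchIn≢ i j (cong pred eq)

  punchOut-punchIn : ∀ i j → punchOut i (punchIn i j) ≡ j
  punchOut-punchIn zero    j       = refl
  punchOut-punchIn (suc i) zero    = refl
  punchOut-punchIn (suc i) (suc j) = cong suc (punchOut-punchIn i j)

  punchIn-punchOut : ∀ {i j} → j ≢ i → punchIn i (punchOut i j) ≡ j
  punchIn-punchOut {zero}  {zero}  j≢i = ⊥-elim (j≢i refl)
  punchIn-punchOut {zero}  {suc j} _   = refl
  punchIn-punchOut {suc i} {zero}  _   = refl
  punchIn-punchOut {suc i} {suc j} j≢i = cong suc (punchIn-punchOut (j≢i ∘ cong suc))

  punchIn-injective : ∀ i {j j′} → punchIn i j ≡ punchIn i j′ → j ≡ j′
  punchIn-injective i {j} {j′} eq =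
    trans (sym (punchOut-punchIn i j)) (trans (cong (punchOut i) eq) (punchOut-punchIn i j′))

  punchIn-below : ∀ {i j} → j < i → punchIn i j ≡ j
  punchIn-below {suc i} {zero}  _         = refl
  punchIn-below {suc i} {suc j} (s≤s j<i) = cong suc (punchIn-below j<i)

  punchIn-mono-< : ∀ i {j j′} → j < j′ → punchIn i j < punchIn i j′
  punchIn-mono-< zero    j<j′ = s≤s j<j′
  punchIn-mono-< (suc i) {zero}  {suc j′} _          = s≤s z≤n
  punchIn-mono-< (suc i) {suc j} {suc j′} (s≤s j<j′) = s≤s (punchIn-mono-< i j<j′)

  punchIn-cancel-< : ∀ i {j j′} → punchIn i j < punchIn i j′ → j < j′
  punchIn-cancel-< zero    lt = ≤-pred lt
  punchIn-cancel-< (suc i) {zero}  {suc j′} _        = s≤s z≤n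
  punchIn-cancel-< (suc i) {suc j} {suc j′} (s≤s lt) = s≤s (punchIn-cancel-< i lt)

  punchIn-<-⇔ : ∀ i {j j′} → punchIn i j < punchIn i j′ ⇔ j < j′
  punchIn-<-⇔ i = mk⇔ (punchIn-cancel-< i) (punchIn-mono-< i)

  punchIn-≤-⇔ : ∀ i {j j′} → punchIn i j ≤ punchIn i j′ ⇔ j ≤ j′
  punchIn-≤-⇔ i = mk⇔ (λ le → ≮⇒≥ (λ lt → <⇒≱ (punchIn-mono-< i lt) le))
                      (λ le → ≮⇒≥ (λ lt → <⇒≱ (punchIn-cancel-< i lt) le))

  punchIn-<-suc-⇔ : ∀ {i n j} → i ≤ n → punchIn i j < suc n ⇔ j < n
  punchIn-<-suc-⇔ {zero}                  _         = mk⇔ ≤-pred s≤s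
  punchIn-<-suc-⇔ {suc i} {suc n} {zero}  _         = mk⇔ (λ _ → s≤s z≤n) (λ _ → s≤s z≤n)
  punchIn-<-suc-⇔ {suc i} {suc n} {suc j} (s≤s i≤n) =
    mk⇔ (s≤s ∘ to (punchIn-<-suc-⇔ i≤n) ∘ ≤-pred) (s≤s ∘ from (punchIn-<-suc-⇔ i≤n) ∘ ≤-pred)

  punchIn-<-⇔-below : ∀ {i r j} → r ≤ i → punchIn i j < r ⇔ j < r
  punchIn-<-⇔-below {r = zero}              _         = mk⇔ (λ ()) (λ ())
  punchIn-<-⇔-below {suc i} {suc r} {zero}  _         = mk⇔ (λ _ → s≤s z≤n) (λ _ → s≤s z≤n)
  punchIn-<-⇔-below {suc i} {suc r} {suc j} (s≤s r≤i) =
    mk⇔ (s≤s ∘ to (punchIn-<-⇔-below r≤i) ∘ ≤-pred) (s≤s ∘ from (punchIn-<-⇔-below r≤i) ∘ ≤-pred)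

  insertAt : ∀ {A : Set} → ℕ → A → List A → List A
  insertAt zero    x w       = x ∷ w
  insertAt (suc i) x []      = x ∷ []
  insertAt (suc i) x (y ∷ w) = y ∷ insertAt i x w

  removeAt : ∀ {A : Set} → ℕ → List A → List A
  removeAt _       []      = []
  removeAt zero    (y ∷ w) = w
  removeAt (suc i) (y ∷ w) = y ∷ removeAt i w

  insertAt-↭ : ∀ {A : Set} i (x : A) w → insertAt i x w ↭ x ∷ w
  insertAt-↭ zero    x w       = ↭-refl
  insertAt-↭ (suc i) x []      = ↭-refl
  insertAt-↭ (suc i) x (y ∷ w) = ↭-trans (↭-prep y (insertAt-↭ i x w)) (↭-swap y x ↭-refl)

  removeAt-insertAt : ∀ {A : Set} {i} (x : A) w → i ≤ length w → removeAt i (insertAt i x w) ≡ w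
  removeAt-insertAt {i = zero}  x w       _         = refl
  removeAt-insertAt {i = suc i} x (y ∷ w) (s≤s i≤n) = cong (y ∷_) (removeAt-insertAt x w i≤n)

  insertAt-removeAt : ∀ {i} w → i < length w → insertAt i (at w i) (removeAt i w) ≡ w
  insertAt-removeAt {zero}  (y ∷ w)     _         = refl
  insertAt-removeAt {suc i} (y ∷ z ∷ w) (s≤s i<n) = cong (y ∷_) (insertAt-removeAt (z ∷ w) i<n)

  at-∈ : ∀ w {j} → j < length w → at w j ∈ w
  at-∈ (x ∷ w) {zero}  _         = here refl
  at-∈ (x ∷ w) {suc j} (s≤s j<n) = there (at-∈ w j<n)

  at-map : ∀ (f : ℕ → ℕ) w {j} → j < length w → at (map f w) j ≡ f (at w j)
  at-map f (x ∷ w) {zero}  _         = refl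
  at-map f (x ∷ w) {suc j} (s≤s j<n) = at-map f w j<n

  at-insertAt : ∀ {i} x w → i ≤ length w → at (insertAt i x w) i ≡ x
  at-insertAt {zero}  x w       _         = refl
  at-insertAt {suc i} x (y ∷ w) (s≤s i≤n) = at-insertAt x w i≤n

  at-insertAt-punchIn : ∀ i x w {j} → j < length w → at (insertAt i x w) (punchIn i j) ≡ at w j
  at-insertAt-punchIn zero    x w       _                 = refl
  at-insertAt-punchIn (suc i) x (y ∷ w) {zero}  _         = refl
  at-insertAt-punchIn (suc i) x (y ∷ w) {suc j} (s≤s j<n) = at-insertAt-punchIn i x w j<n

  -- the first position of x in w; it is length w when x does not occur
  indexOf : ℕ → List ℕ → ℕ
  indexOf x []      = 0
  indexOf x (y ∷ w) with x ≟ y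
  ... | yes _ = 0
  ... | no  _ = suc (indexOf x w)

  indexOf-< : ∀ {x w} → x ∈ w → indexOf x w < length w
  indexOf-< {x} {y ∷ w} x∈ with x ≟ y
  ... | yes _ = s≤s z≤n
  indexOf-< {x} {y ∷ w} (here x≡y) | no x≢y = ⊥-elim (x≢y x≡y)
  indexOf-< {x} {y ∷ w} (there x∈) | no _   = s≤s (indexOf-< x∈)

  at-indexOf : ∀ {x w} → x ∈ w → at w (indexOf x w) ≡ x
  at-indexOf {x} {y ∷ w} x∈ with x ≟ y
  ... | yes x≡y = sym x≡y
  at-indexOf {x} {y ∷ w} (here x≡y) | no x≢y = ⊥-elim (x≢y x≡y)
  at-indexOf {x} {y ∷ w} (there x∈) | no _   = at-indexOf x∈

  at-before-indexOf : ∀ {x w j} → j < indexOf x w → at w j ≢ x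
  at-before-indexOf {x} {y ∷ w} {j} j< with x ≟ y
  at-before-indexOf {x} {y ∷ w} {zero}  _        | no x≢y = x≢y ∘ sym
  at-before-indexOf {x} {y ∷ w} {suc j} (s≤s j<) | no _   = at-before-indexOf {w = w} j<

  indexOf-insertAt : ∀ {x i} w → x ∉ w → i ≤ length w → indexOf x (insertAt i x w) ≡ i
  indexOf-insertAt {x} {zero} w _ _ with x ≟ x
  ... | yes _  = refl
  ... | no x≢x = ⊥-elim (x≢x refl)
  indexOf-insertAt {x} {suc i} (y ∷ w) x∉ (s≤s i≤n) with x ≟ y
  ... | yes x≡y = ⊥-elim (x∉ (here x≡y))
  ... | no _    = cong suc (indexOf-insertAt w (x∉ ∘ there) i≤n)

  indexOf-insertAt-≢ : ∀ {x y i} w → y ≢ x → i ≤ length w →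
                       indexOf y (insertAt i x w) ≡ punchIn i (indexOf y w)
  indexOf-insertAt-≢ {x} {y} {zero} w y≢x _ with y ≟ x
  ... | yes y≡x = ⊥-elim (y≢x y≡x)
  ... | no _    = refl
  indexOf-insertAt-≢ {x} {y} {suc i} (z ∷ w) y≢x (s≤s i≤n) with y ≟ z
  ... | yes _ = refl
  ... | no _  = cong suc (indexOf-insertAt-≢ w y≢x i≤n)

  indexOf-map : ∀ {f : ℕ → ℕ} → (∀ {x y} → f x ≡ f y → x ≡ y) → ∀ x w → indexOf (f x) (map f w) ≡ indexOf x w
  indexOf-map         f-inj x []      = refl
  indexOf-map {f = f} f-inj x (y ∷ w) with f x ≟ f y | x ≟ y
  ... | yes _     | yes _   = refl
  ... | yes fx≡fy | no x≢y  = ⊥-elim (x≢y (f-inj fx≡fy))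
  ... | no fx≢fy  | yes x≡y = ⊥-elim (fx≢fy (cong f x≡y))
  ... | no _      | no _    = cong suc (indexOf-map f-inj x w)

  removeAt-indexOf-↭ : ∀ {x w} → x ∈ w → w ↭ x ∷ removeAt (indexOf x w) w
  removeAt-indexOf-↭ {x} {w} x∈w = subst (λ y → w ↭ y ∷ removeAt p w) (at-indexOf x∈w)
    (subst (_↭ at w p ∷ removeAt p w) (insertAt-removeAt w (indexOf-< x∈w)) (insertAt-↭ p (at w p) (removeAt p w)))
    where p = indexOf x w

  insertValue : ℕ → ℕ → List ℕ → List ℕ
  insertValue i v w = insertAt i v (map (punchIn v) w)

  removeValue : ℕ → List ℕ → List ℕ
  removeValue v z = map (punchOut v) (removeAt (indexOf v z) z)

  ∉-map-punchIn : ∀ v w → v ∉ map (punchIn v) w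
  ∉-map-punchIn v w v∈ with ∈-map⁻ (punchIn v) v∈
  ... | x , _ , v≡ = punchIn≢ v x (sym v≡)

  map-punchIn-punchOut : ∀ {v u} → v ∉ u → map (punchIn v) (map (punchOut v) u) ≡ u
  map-punchIn-punchOut {v} {u} v∉u = trans (sym (map-∘ u))
    (map-id-local (All.tabulate λ {x} x∈ → punchIn-punchOut λ x≡v → v∉u (subst (_∈ u) x≡v x∈)))

  map-punchIn-below : ∀ {v w} → All (_< v) w → map (punchIn v) w ≡ w
  map-punchIn-below w<v = map-id-local (All.map punchIn-below w<v)

  length-insertValue : ∀ i v w → length (insertValue i v w) ≡ suc (length w)
  length-insertValue i v w =
    trans (↭-length (insertAt-↭ i v (map (punchIn v) w))) (cong suc (length-map (punchIn v) w))

  at-insertValue-punchIn : ∀ i v w {j} → j < length w → at (insertValue i v w) (punchIn i j) ≡ punchIn v (at w j)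
  at-insertValue-punchIn i v w {j} j<n = trans
    (at-insertAt-punchIn i v (map (punchIn v) w) (subst (j <_) (sym (length-map (punchIn v) w)) j<n))
    (at-map (punchIn v) w j<n)

  module _ {i v : ℕ} {w : List ℕ} (i≤∣w∣ : i ≤ length w) where

    private
      i≤∣w′∣ : i ≤ length (map (punchIn v) w)
      i≤∣w′∣ = subst (i ≤_) (sym (length-map (punchIn v) w)) i≤∣w∣

    at-insertValue : at (insertValue i v w) i ≡ v
    at-insertValue = at-insertAt v (map (punchIn v) w) i≤∣w′∣

    indexOf-insertValue : indexOf v (insertValue i v w) ≡ i
    indexOf-insertValue = indexOf-insertAt (map (punchIn v) w) (∉-map-punchIn v w) i≤∣w′∣

    indexOf-insertValue-punchIn : ∀ y → indexOf (punchIn v y) (insertValue i v w) ≡ punchIn i (indexOf y w)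
    indexOf-insertValue-punchIn y = trans (indexOf-insertAt-≢ (map (punchIn v) w) (punchIn≢ v y) i≤∣w′∣)
                                          (cong (punchIn i) (indexOf-map (punchIn-injective v) y w))

    removeValue-insertValue : removeValue v (insertValue i v w) ≡ w
    removeValue-insertValue = begin
      map (punchOut v) (removeAt (indexOf v (insertValue i v w)) (insertValue i v w))
        ≡⟨ cong (λ p → map (punchOut v) (removeAt p (insertValue i v w))) indexOf-insertValue ⟩
      map (punchOut v) (removeAt i (insertAt i v (map (punchIn v) w)))
        ≡⟨ cong (map (punchOut v)) (removeAt-insertAt v (map (punchIn v) w) i≤∣w′∣) ⟩
      map (punchOut v) (map (punchIn v) w)  ≡⟨ map-∘ w ⟨
      map (punchOut v ∘ punchIn v) w        ≡⟨ map-cong (punchOut-punchIn v) w ⟩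
      map id w                              ≡⟨ map-id w ⟩
      w                                     ∎
      where open ≡-Reasoning

  insertValue-removeValue : ∀ {v z} → Unique z → v ∈ z → insertValue (indexOf v z) v (removeValue v z) ≡ z
  insertValue-removeValue {v} {z} uz v∈z = begin
    insertAt p v (map (punchIn v) (map (punchOut v) rest)) ≡⟨ cong (insertAt p v) (map-punchIn-punchOut v∉rest) ⟩
    insertAt p v rest                                      ≡⟨ cong (λ x → insertAt p x rest) (at-indexOf v∈z) ⟨
    insertAt p (at z p) rest                               ≡⟨ insertAt-removeAt z (indexOf-< v∈z) ⟩
    z                                                      ∎
    where
    open ≡-Reasoning
    p : ℕ
    p = indexOf v z
    rest : List ℕ
    rest = removeAt p z
    v∉rest : v ∉ rest
    v∉rest with Unique-resp-↭ (↭⇒↭ₛ (removeAt-indexOf-↭ v∈z)) uz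
    ... | v≢rest ∷ _ = λ v∈ → All.lookup v≢rest v∈ refl

  -- Permutations

  Unique-⊆⇒length-≤ : ∀ {xs ys : List ℕ} → Unique xs → xs ⊆ ys → length xs ≤ length ys
  Unique-⊆⇒length-≤ {[]}          _          _   = z≤n
  Unique-⊆⇒length-≤ {x ∷ xs} {ys} (x∉xs ∷ u) sub =
    subst (suc (length xs) ≤_) (sym (↭-length ys↭)) (s≤s (Unique-⊆⇒length-≤ u sub′))
    where
    ys↭ : ys ↭ x ∷ removeAt (indexOf x ys) ys
    ys↭ = removeAt-indexOf-↭ (sub (here refl))
    sub′ : xs ⊆ removeAt (indexOf x ys) ys
    sub′ y∈ with ∈-resp-↭ ys↭ (sub (there y∈))
    ... | here y≡x  = ⊥-elim (All.lookup x∉xs y∈ (sym y≡x))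
    ... | there y∈′ = y∈′

  record IsPerm (n : ℕ) (z : List ℕ) : Set where
    constructor isPerm
    field
      length≡ : length z ≡ n
      bounded : All (_< n) z
      unique  : Unique z

  open IsPerm

  IsPerm-∋ : ∀ {n z x} → IsPerm n z → x < n → x ∈ z
  IsPerm-∋ {n} {z} {x} pz x<n with x ∈? z
  ... | yes x∈z = x∈z
  ... | no  x∉z = ⊥-elim (1+n≰n (subst₂ (λ a b → suc a ≤ b) (length≡ pz) (length-upTo n) too-long))
    where
    too-long : length (x ∷ z) ≤ length (upTo n)
    too-long = Unique-⊆⇒length-≤ (¬Any⇒All¬ z x∉z ∷ unique pz)
      λ { (here refl) → ∈-upTo⁺ x<n ; (there y∈z) → ∈-upTo⁺ (All.lookup (bounded pz) y∈z) }

  IsPerm-at-< : ∀ {n z j} → IsPerm n z → j < length z → at z j < n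
  IsPerm-at-< {z = z} pz j<n = All.lookup (bounded pz) (at-∈ z j<n)

  IsPerm-resp-↭ : ∀ {n z z′} → z ↭ z′ → IsPerm n z → IsPerm n z′
  IsPerm-resp-↭ z↭ (isPerm l b u) =
    isPerm (trans (sym (↭-length z↭)) l) (All-resp-↭ z↭ b) (Unique-resp-↭ (↭⇒↭ₛ z↭) u)

  IsPerm-∷-punchIn : ∀ {n v w} → v ≤ n → IsPerm n w → IsPerm (suc n) (v ∷ map (punchIn v) w)
  IsPerm-∷-punchIn {n} {v} {w} v≤n (isPerm l b u) = isPerm
    (cong suc (trans (length-map (punchIn v) w) l))
    (s≤s v≤n ∷ All-map⁺ (All.map (from (punchIn-<-suc-⇔ v≤n)) b))
    (¬Any⇒All¬ _ (∉-map-punchIn v w) ∷ Unique.map⁺ (punchIn-injective v) u)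

  IsPerm-∷-punchOut : ∀ {n v u} → IsPerm (suc n) (v ∷ u) → IsPerm n (map (punchOut v) u)
  IsPerm-∷-punchOut {n} {v} {u} (isPerm l (s≤s v≤n ∷ b) (v≢u ∷ uu)) = isPerm
    (trans (length-map (punchOut v) u) (suc-injective l))
    (All-map⁺ (All.tabulate bound))
    (Unique.map⁻ (subst Unique (sym (map-punchIn-punchOut λ v∈ → All.lookup v≢u v∈ refl)) uu))
    where
    bound : ∀ {x} → x ∈ u → punchOut v x < n
    bound x∈ = to (punchIn-<-suc-⇔ v≤n)
      (subst (_< suc n) (sym (punchIn-punchOut λ x≡v → All.lookup v≢u x∈ (sym x≡v))) (All.lookup b x∈))

  IsPerm-insertValue : ∀ {n v w} i → v ≤ n → IsPerm n w → IsPerm (suc n) (insertValue i v w)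
  IsPerm-insertValue {v = v} {w} i v≤n pw =
    IsPerm-resp-↭ (↭-sym (insertAt-↭ i v (map (punchIn v) w))) (IsPerm-∷-punchIn v≤n pw)

  IsPerm-removeValue : ∀ {n v z} → v ≤ n → IsPerm (suc n) z → IsPerm n (removeValue v z)
  IsPerm-removeValue v≤n pz =
    IsPerm-∷-punchOut (IsPerm-resp-↭ (removeAt-indexOf-↭ (IsPerm-∋ pz (s≤s v≤n))) pz)

  words≡cartesianProduct : ∀ m l → words m (suc l) ≡ cartesianProductWith _∷_ (upTo m) (words m l)
  words≡cartesianProduct m l = go (upTo m)
    where
    go : ∀ xs → concatMap (λ x → map (x ∷_) (words m l)) xs ≡ cartesianProductWith _∷_ xs (words m l)
    go []       = refl
    go (x ∷ xs) = cong (map (x ∷_) (words m l) ++_) (go xs)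

  ∈-words⁻ : ∀ {m} l {z} → z ∈ words m l → length z ≡ l × All (_< m) z
  ∈-words⁻ zero (here refl) = refl , []
  ∈-words⁻ {m} (suc l) z∈
    with ∈-cartesianProductWith⁻ _∷_ (upTo m) (words m l) (subst (_ ∈_) (words≡cartesianProduct m l) z∈)
  ... | x , t , x∈ , t∈ , refl = let l≡ , bt = ∈-words⁻ l t∈ in cong suc l≡ , ∈-upTo⁻ x∈ ∷ bt

  ∈-words⁺ : ∀ {m} z → All (_< m) z → z ∈ words m (length z)
  ∈-words⁺     []      []         = here refl
  ∈-words⁺ {m} (x ∷ z) (x<m ∷ bz) = subst (_ ∈_) (sym (words≡cartesianProduct m (length z)))
    (∈-cartesianProductWith⁺ _∷_ (∈-upTo⁺ x<m) (∈-words⁺ z bz))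

  words-unique : ∀ m l → Unique (words m l)
  words-unique m zero    = [] ∷ []
  words-unique m (suc l) = subst Unique (sym (words≡cartesianProduct m l))
    (Unique.cartesianProductWith⁺ _∷_ ∷-injective (Unique.upTo⁺ m) (words-unique m l))

  ∈-perms⇔ : ∀ {n z} → z ∈ perms n ⇔ IsPerm n z
  ∈-perms⇔ {n} {z} = mk⇔
    (λ z∈ → let z∈w , uz = ∈-filter⁻ unique? z∈ ; l , bz = ∈-words⁻ n z∈w in isPerm l bz uz)
    (λ { (isPerm refl bz uz) → ∈-filter⁺ unique? (∈-words⁺ z bz) uz })

  perms-unique : ∀ n → Unique (perms n)
  perms-unique n = Unique.filter⁺ unique? (words-unique n n)

  length-cartesianProduct : ∀ {A B : Set} (xs : List A) (ys : List B) →
                            length (cartesianProduct xs ys) ≡ length xs * length ys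
  length-cartesianProduct []       ys = refl
  length-cartesianProduct (x ∷ xs) ys = begin
    length (map (x ,_) ys ++ cartesianProduct xs ys)         ≡⟨ length-++ (map (x ,_) ys) ⟩
    length (map (x ,_) ys) + length (cartesianProduct xs ys) ≡⟨ cong₂ _+_ (length-map (x ,_) ys)
                                                                           (length-cartesianProduct xs ys) ⟩
    length ys + length xs * length ys                        ∎
    where open ≡-Reasoning

  length-≡-by-inverses : ∀ {A B : Set} {xs : List A} {ys : List B} → Unique xs → Unique ys →
    (f : A → B) (g : B → A) → (∀ {x} → x ∈ xs → f x ∈ ys) → (∀ {y} → y ∈ ys → g y ∈ xs) →
    (∀ {x} → x ∈ xs → g (f x) ≡ x) → (∀ {y} → y ∈ ys → f (g y) ≡ y) → length xs ≡ length ys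
  length-≡-by-inverses {xs = xs} {ys} uxs uys f g f∈ g∈ gf fg =
    trans (sym (length-map f xs)) (↭-length (∼bag⇒↭ (unique∧set⇒bag ufxs uys (mk⇔ to-ys from-ys))))
    where
    ufxs : Unique (map f xs)
    ufxs = Unique.map⁻ {f = g} (subst Unique (sym (trans (sym (map-∘ xs)) (map-id-local (All.tabulate gf)))) uxs)
    to-ys : ∀ {y} → y ∈ map f xs → y ∈ ys
    to-ys y∈ with ∈-map⁻ f y∈
    ... | x , x∈ , refl = f∈ x∈
    from-ys : ∀ {y} → y ∈ ys → y ∈ map f xs
    from-ys y∈ = subst (_∈ map f xs) (fg y∈) (∈-map⁺ f (g∈ y∈))

  length-filter-∩-∁ : ∀ {A : Set} {P Q : Pred A 0ℓ} (P? : Decidable P) (Q? : Decidable Q) xs →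
    length (filter P? xs) ≡ length (filter (P? ∩? Q?) xs) + length (filter (P? ∩? ∁? Q?) xs)
  length-filter-∩-∁ P? Q? [] = refl
  length-filter-∩-∁ P? Q? (x ∷ xs) with P? x | Q? x
  ... | no  _ | _     = length-filter-∩-∁ P? Q? xs
  ... | yes _ | yes _ = cong suc (length-filter-∩-∁ P? Q? xs)
  ... | yes _ | no  _ = trans (cong suc (length-filter-∩-∁ P? Q? xs)) (sym (+-suc _ _))

  count : ∀ {P : Pred (List ℕ) 0ℓ} → Decidable P → ℕ → ℕ
  count P? n = length (filter P? (perms n))

  ∈-filter-perms⇔ : ∀ {P : Pred (List ℕ) 0ℓ} (P? : Decidable P) {n z} → z ∈ filter P? (perms n) ⇔ (IsPerm n z × P z)
  ∈-filter-perms⇔ P? = mk⇔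
    (λ z∈ → let z∈ps , Pz = ∈-filter⁻ P? z∈ in to ∈-perms⇔ z∈ps , Pz)
    (λ (pz , Pz) → ∈-filter⁺ P? (from ∈-perms⇔ pz) Pz)

  count-split : ∀ {P Q : Pred (List ℕ) 0ℓ} (P? : Decidable P) (Q? : Decidable Q) n →
                count P? n ≡ count (P? ∩? Q?) n + count (P? ∩? ∁? Q?) n
  count-split P? Q? n = length-filter-∩-∁ P? Q? (perms n)

  count-all : ∀ {P : Pred (List ℕ) 0ℓ} (P? : Decidable P) {n} → (∀ {z} → IsPerm n z → P z) →
              count P? n ≡ length (perms n)
  count-all P? all = cong length (filter-all P? (All.tabulate (all ∘ to ∈-perms⇔)))

  count-none : ∀ {P : Pred (List ℕ) 0ℓ} (P? : Decidable P) {n} → (∀ {z} → IsPerm n z → ¬ P z) → count P? n ≡ 0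
  count-none P? none = cong length (filter-none P? (All.tabulate (none ∘ to ∈-perms⇔)))

  count-≐ : ∀ {P Q : Pred (List ℕ) 0ℓ} (P? : Decidable P) (Q? : Decidable Q) → P ≐ Q → ∀ n → count P? n ≡ count Q? n
  count-≐ P? Q? P≐Q n = cong length (filter-≐ P? Q? P≐Q (perms n))

  count-inclusion-exclusion : ∀ {P Q Q′ : Pred (List ℕ) 0ℓ} (P? : Decidable P) (Q? : Decidable Q) (Q′? : Decidable Q′) n →
    count P? n + count ((P? ∩? ∁? Q′?) ∩? Q?) n
    ≡ count (P? ∩? Q?) n + count (P? ∩? ∁? Q′?) n + count ((P? ∩? ∁? Q?) ∩? Q′?) n
  count-inclusion-exclusion P? Q? Q′? n = begin
    count P? n + #Q∖Q′                  ≡⟨ cong (_+ #Q∖Q′) split-P ⟩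
    (#Q + (#Q′∖Q + #∁Q∪Q′)) + #Q∖Q′     ≡⟨ solve 4 (λ x y z t → (x :+ (y :+ z)) :+ t := x :+ (t :+ z) :+ y)
                                                refl #Q #Q′∖Q #∁Q∪Q′ #Q∖Q′ ⟩
    #Q + (#Q∖Q′ + #∁Q∪Q′) + #Q′∖Q       ≡⟨ cong (λ t → #Q + t + #Q′∖Q) split-∁Q′ ⟨
    #Q + count (P? ∩? ∁? Q′?) n + #Q′∖Q ∎
    where
    open ≡-Reasoning
    open +-*-Solver using (solve; _:+_; _:=_)
    #Q = count (P? ∩? Q?) n
    #Q∖Q′ = count ((P? ∩? ∁? Q′?) ∩? Q?) n
    #Q′∖Q = count ((P? ∩? ∁? Q?) ∩? Q′?) n
    #∁Q∪Q′ = count ((P? ∩? ∁? Q?) ∩? ∁? Q′?) n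
    split-P : count P? n ≡ #Q + (#Q′∖Q + #∁Q∪Q′)
    split-P = trans (count-split P? Q? n) (cong (#Q +_) (count-split (P? ∩? ∁? Q?) Q′? n))
    split-∁Q′ : count (P? ∩? ∁? Q′?) n ≡ #Q∖Q′ + #∁Q∪Q′
    split-∁Q′ = trans (count-split (P? ∩? ∁? Q′?) Q? n)
      (cong (#Q∖Q′ +_) (count-≐ _ _ ((λ ((p , q′) , q) → (p , q) , q′) , (λ ((p , q) , q′) → (p , q′) , q)) n))

  -- (i , w) ↦ insertValue (lo + i) v w is a bijection from [0, c) × P onto P′,
  -- with inverse z ↦ (indexOf v z ∸ lo , removeValue v z)
  module InsertionCount {P P′ : Pred (List ℕ) 0ℓ} (P? : Decidable P) (P′? : Decidable P′) {n v lo c : ℕ}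
    (v≤n : v ≤ n) (lo+c≤ : lo + c ≤ suc n)
    (insert⇔ : ∀ {w i} → IsPerm n w → i < c → P′ (insertValue (lo + i) v w) ⇔ P w)
    (window : ∀ {z} → IsPerm (suc n) z → P′ z → lo ≤ indexOf v z × indexOf v z < lo + c) where

    private
      xs : List (ℕ × List ℕ)
      xs = cartesianProduct (upTo c) (filter P? (perms n))

      ys : List (List ℕ)
      ys = filter P′? (perms (suc n))

      f : ℕ × List ℕ → List ℕ
      f (i , w) = insertValue (lo + i) v w

      g : List ℕ → ℕ × List ℕ
      g z = indexOf v z ∸ lo , removeValue v z

      ∈xs⁻ : ∀ {i w} → (i , w) ∈ xs → i < c × IsPerm n w × P w
      ∈xs⁻ x∈ = let i∈ , w∈ = ∈-cartesianProduct⁻ (upTo c) _ x∈ in ∈-upTo⁻ i∈ , to (∈-filter-perms⇔ P?) w∈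

      ∈ys⁻ : ∀ {z} → z ∈ ys → IsPerm (suc n) z × P′ z
      ∈ys⁻ = to (∈-filter-perms⇔ P′? {suc n})

      lo+i≤∣w∣ : ∀ {i w} → i < c → IsPerm n w → lo + i ≤ length w
      lo+i≤∣w∣ {i} i<c pw = subst (lo + i ≤_) (sym (length≡ pw)) (≤-pred (≤-trans (+-monoʳ-< lo i<c) lo+c≤))

      f∈ : ∀ {x} → x ∈ xs → f x ∈ ys
      f∈ {i , w} x∈ = let i<c , pw , Pw = ∈xs⁻ x∈ in
        from (∈-filter-perms⇔ P′?) (IsPerm-insertValue (lo + i) v≤n pw , from (insert⇔ pw i<c) Pw)

      gf : ∀ {x} → x ∈ xs → g (f x) ≡ x
      gf {i , w} x∈ = let i<c , pw , _ = ∈xs⁻ x∈ in cong₂ _,_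
        (trans (cong (_∸ lo) (indexOf-insertValue (lo+i≤∣w∣ i<c pw))) (m+n∸m≡n lo i))
        (removeValue-insertValue (lo+i≤∣w∣ i<c pw))

      fg : ∀ {z} → z ∈ ys → f (g z) ≡ z
      fg {z} z∈ = let pz , P′z = ∈ys⁻ z∈ in trans
        (cong (λ p → insertValue p v (removeValue v z)) (m+[n∸m]≡n (proj₁ (window pz P′z))))
        (insertValue-removeValue (unique pz) (IsPerm-∋ pz (s≤s v≤n)))

      g∈ : ∀ {z} → z ∈ ys → g z ∈ xs
      g∈ {z} z∈ = ∈-cartesianProduct⁺ (∈-upTo⁺ i<c) (from (∈-filter-perms⇔ P?) (pw , P-removed))
        where
        pz : IsPerm (suc n) z
        pz = proj₁ (∈ys⁻ z∈)
        P′z : P′ z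
        P′z = proj₂ (∈ys⁻ z∈)
        i<c : indexOf v z ∸ lo < c
        i<c = +-cancelˡ-< lo _ _
          (subst (_< lo + c) (sym (m+[n∸m]≡n (proj₁ (window pz P′z)))) (proj₂ (window pz P′z)))
        pw : IsPerm n (removeValue v z)
        pw = IsPerm-removeValue v≤n pz
        P-removed : P (removeValue v z)
        P-removed = to (insert⇔ pw i<c) (subst P′ (sym (fg z∈)) P′z)

    count-insertValue : count P′? (suc n) ≡ c * count P? n
    count-insertValue = begin
      count P′? (suc n)             ≡⟨ length-≡-by-inverses uxs uys f g f∈ g∈ gf fg ⟨
      length xs                     ≡⟨ length-cartesianProduct (upTo c) (filter P? (perms n)) ⟩
      length (upTo c) * count P? n  ≡⟨ cong (_* count P? n) (length-upTo c) ⟩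
      c * count P? n                ∎
      where
      open ≡-Reasoning
      uxs : Unique xs
      uxs = Unique.cartesianProduct⁺ (Unique.upTo⁺ c) (Unique.filter⁺ P? (perms-unique n))
      uys : Unique ys
      uys = Unique.filter⁺ P′? (perms-unique (suc n))

  open InsertionCount using (count-insertValue)

  length-perms : ∀ n → length (perms n) ≡ n !
  length-perms zero    = refl
  length-perms (suc n) = begin
    length (perms (suc n)) ≡⟨ count-all U? {suc n} _ ⟨
    count U? (suc n)       ≡⟨ count-insertValue U? U? {n} {n} {0} ≤-refl ≤-refl (λ _ _ → mk⇔ _ _) window ⟩
    suc n * count U? n     ≡⟨ cong (suc n *_) (trans (count-all U? {n} _) (length-perms n)) ⟩
    suc n * n !            ∎
    where
    open ≡-Reasoning
    window : ∀ {z} → IsPerm (suc n) z → U z → 0 ≤ indexOf n z × indexOf n z < suc n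
    window {z} pz _ = z≤n , subst (indexOf n z <_) (length≡ pz) (indexOf-< (IsPerm-∋ pz ≤-refl))

  -- Pattern occurrences

  record Occ3|12 (r : ℕ) (w : List ℕ) (j₁ j₂ j₃ : ℕ) : Set where
    constructor occ3|12
    field
      j₁<r   : j₁ < r
      r≤j₂   : r ≤ j₂
      j₂<j₃  : j₂ < j₃
      j₃<∣w∣ : j₃ < length w
      w₂<w₃  : at w j₂ < at w j₃
      w₃<w₁  : at w j₃ < at w j₁

  record Occ23|1 (r : ℕ) (w : List ℕ) (j₁ j₂ j₃ : ℕ) : Set where
    constructor occ23|1
    field
      j₁<j₂  : j₁ < j₂
      j₂<r   : j₂ < r
      r≤j₃   : r ≤ j₃
      j₃<∣w∣ : j₃ < length w
      w₃<w₁  : at w j₃ < at w j₁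
      w₁<w₂  : at w j₁ < at w j₂

  Avoids : ℕ → List ℕ → Set
  Avoids r w = (∀ {j₁ j₂ j₃} → ¬ Occ3|12 r w j₁ j₂ j₃) × (∀ {j₁ j₂ j₃} → ¬ Occ23|1 r w j₁ j₂ j₃)

  T-any-upTo : ∀ (p : ℕ → Bool) n → T (any p (upTo n)) ⇔ (∃ λ j → j < n × T (p j))
  T-any-upTo p n = mk⇔ (applyUpTo⁻ id ∘ any⁻ p (upTo n)) (λ (_ , j<n , t) → any⁺ p (applyUpTo⁺ id t j<n))

  T-<ᵇ : ∀ {m n} → T (m <ᵇ n) ⇔ m < n
  T-<ᵇ {m} {n} = mk⇔ (<ᵇ⇒< m n) <⇒<ᵇ

  T-≤ᵇ' : ∀ {m n} → T (m ≤ᵇ' n) ⇔ m ≤ n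
  T-≤ᵇ' = mk⇔ (≤-pred ∘ to T-<ᵇ) (from T-<ᵇ ∘ s≤s)

  T-contains3|12 : ∀ {r w} → T (contains3|12 r w) ⇔ (∃ λ j₁ → ∃ λ j₂ → ∃ λ j₃ → Occ3|12 r w j₁ j₂ j₃)
  T-contains3|12 {r} {w} = mk⇔
    (λ t → let j₁ , _ , t₁ = to (T-any-upTo _ n) t ; j₂ , _ , t₂ = to (T-any-upTo _ n) t₁
               j₃ , j₃<n , t₃ = to (T-any-upTo _ n) t₂
               a , t₄ = to T-∧ t₃ ; b , t₅ = to T-∧ t₄ ; c , t₆ = to T-∧ t₅ ; d , e = to T-∧ t₆
           in j₁ , j₂ , j₃ , occ3|12 (to T-<ᵇ a) (to T-≤ᵇ' b) (to T-<ᵇ c) j₃<n (to T-<ᵇ d) (to T-<ᵇ e))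
    (λ (j₁ , j₂ , j₃ , occ3|12 a b c d e f) → let j₂<n = <-trans c d in
      from (T-any-upTo _ n) (j₁ , <-trans (<-≤-trans a b) j₂<n , from (T-any-upTo _ n) (j₂ , j₂<n ,
      from (T-any-upTo _ n) (j₃ , d , from T-∧ (from T-<ᵇ a , from T-∧ (from T-≤ᵇ' b ,
      from T-∧ (from T-<ᵇ c , from T-∧ (from T-<ᵇ e , from T-<ᵇ f))))))))
    where n = length w

  T-contains23|1 : ∀ {r w} → T (contains23|1 r w) ⇔ (∃ λ j₁ → ∃ λ j₂ → ∃ λ j₃ → Occ23|1 r w j₁ j₂ j₃)
  T-contains23|1 {r} {w} = mk⇔
    (λ t → let j₁ , _ , t₁ = to (T-any-upTo _ n) t ; j₂ , _ , t₂ = to (T-any-upTo _ n) t₁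
               j₃ , j₃<n , t₃ = to (T-any-upTo _ n) t₂
               a , t₄ = to T-∧ t₃ ; b , t₅ = to T-∧ t₄ ; c , t₆ = to T-∧ t₅ ; d , e = to T-∧ t₆
           in j₁ , j₂ , j₃ , occ23|1 (to T-<ᵇ a) (to T-<ᵇ b) (to T-≤ᵇ' c) j₃<n (to T-<ᵇ d) (to T-<ᵇ e))
    (λ (j₁ , j₂ , j₃ , occ23|1 a b c d e f) → let j₂<n = <-≤-trans b (≤-trans c (<⇒≤ d)) in
      from (T-any-upTo _ n) (j₁ , <-trans a j₂<n , from (T-any-upTo _ n) (j₂ , j₂<n ,
      from (T-any-upTo _ n) (j₃ , d , from T-∧ (from T-<ᵇ a , from T-∧ (from T-<ᵇ b ,
      from T-∧ (from T-≤ᵇ' c , from T-∧ (from T-<ᵇ e , from T-<ᵇ f))))))))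
    where n = length w

  avoids≡true⇔ : ∀ {r w} → avoids r w ≡ true ⇔ Avoids r w
  avoids≡true⇔ {r} {w} with contains3|12 r w in c₃ | contains23|1 r w in c₂
  ... | true  | _    = mk⇔ (λ ()) λ (no3|12 , _) →
    let _ , _ , _ , o = to T-contains3|12 (subst T (sym c₃) _) in ⊥-elim (no3|12 o)
  ... | false | true = mk⇔ (λ ()) λ (_ , no23|1) →
    let _ , _ , _ , o = to T-contains23|1 (subst T (sym c₂) _) in ⊥-elim (no23|1 o)
  ... | false | false = mk⇔
    (λ _ → (λ {_} {_} {_} o → subst T c₃ (from T-contains3|12 (_ , _ , _ , o))) ,
           (λ {_} {_} {_} o → subst T c₂ (from T-contains23|1 (_ , _ , _ , o))))
    (λ _ → refl)

  avoids? : ∀ r → Decidable (λ w → avoids r w ≡ true)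
  avoids? r w = avoids r w Bool.≟ true

  avoids-cong : ∀ {r r′ w w′} → Avoids r′ w′ ⇔ Avoids r w → (avoids r′ w′ ≡ true) ⇔ (avoids r w ≡ true)
  avoids-cong e = ⇔-trans avoids≡true⇔ (⇔-trans e (⇔-sym avoids≡true⇔))

  Avoids-0 : ∀ {w} → Avoids 0 w
  Avoids-0 = (λ { (occ3|12 () _ _ _ _ _) }) , (λ { (occ23|1 _ () _ _ _ _) })

  Avoids-short : ∀ {r w} → length w ≤ r → Avoids r w
  Avoids-short ∣w∣≤r =
    (λ { (occ3|12 _ r≤j₂ j₂<j₃ j₃<n _ _) → <⇒≱ (<-trans j₂<j₃ j₃<n) (≤-trans ∣w∣≤r r≤j₂) }) ,
    (λ { (occ23|1 _ _ r≤j₃ j₃<n _ _) → <⇒≱ j₃<n (≤-trans ∣w∣≤r r≤j₃) })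

  k-all : ∀ {r n} → (∀ {w} → IsPerm n w → Avoids r w) → k r n ≡ n !
  k-all {r} {n} all = trans (count-all (avoids? r) (from avoids≡true⇔ ∘ all)) (length-perms n)

  k-boundaryʳ : ∀ r → k r (r + 0) ≡ r !
  k-boundaryʳ r = trans (k-all λ pw → Avoids-short (≤-reflexive (trans (length≡ pw) (+-identityʳ r))))
                        (cong _! (+-identityʳ r))

  k-boundaryˡ : ∀ s → k 0 s ≡ s !
  k-boundaryˡ s = k-all {n = s} λ _ → Avoids-0

  SameBlock : ℕ → ℕ → ℕ → Set
  SameBlock r j₁ j₂ = j₂ < r ⊎ r ≤ j₁

  -- inserting at position i moves the split from r to r′
  BlockPreserving : ℕ → ℕ → ℕ → Set
  BlockPreserving i r r′ = ∀ {j} → punchIn i j < r′ ⇔ j < r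

  blockPreserving-right : ∀ {i r} → r ≤ i → BlockPreserving i r r
  blockPreserving-right r≤i = punchIn-<-⇔-below r≤i

  blockPreserving-left : ∀ {i r} → i ≤ r → BlockPreserving i r (suc r)
  blockPreserving-left i≤r = punchIn-<-suc-⇔ i≤r

  BlockPreserving-≤ : ∀ {i r r′} → BlockPreserving i r r′ → ∀ {j} → r′ ≤ punchIn i j ⇔ r ≤ j
  BlockPreserving-≤ bp = mk⇔ (λ le → ≮⇒≥ (λ lt → <⇒≱ (from bp lt) le)) (λ le → ≮⇒≥ (λ lt → <⇒≱ (to bp lt) le))

  subst₃ : ∀ {A : Set} (R : A → A → A → Set) {a a′ b b′ c c′} → a ≡ a′ → b ≡ b′ → c ≡ c′ → R a b c → R a′ b′ c′
  subst₃ R refl refl refl x = x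

  module InsertValue {i v : ℕ} {w : List ℕ} (i≤∣w∣ : i ≤ length w) where

    z : List ℕ
    z = insertValue i v w

    punchIn-<-length-⇔ : ∀ {j} → punchIn i j < length z ⇔ j < length w
    punchIn-<-length-⇔ {j} =
      subst (λ m → punchIn i j < m ⇔ j < length w) (sym (length-insertValue i v w)) (punchIn-<-suc-⇔ i≤∣w∣)

    at-punchIn-<-⇔ : ∀ {j j′} → j < length w → j′ < length w →
                     at z (punchIn i j) < at z (punchIn i j′) ⇔ at w j < at w j′
    at-punchIn-<-⇔ j<n j′<n rewrite at-insertValue-punchIn i v w j<n | at-insertValue-punchIn i v w j′<n =
      punchIn-<-⇔ v

    at-punchIn-≤-⇔ : ∀ {j j′} → j < length w → j′ < length w →
                     at z (punchIn i j) ≤ at z (punchIn i j′) ⇔ at w j ≤ at w j′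
    at-punchIn-≤-⇔ j<n j′<n rewrite at-insertValue-punchIn i v w j<n | at-insertValue-punchIn i v w j′<n =
      punchIn-≤-⇔ v

    module _ {r r′ : ℕ} (bp : BlockPreserving i r r′) where

      private
        bp≤ : ∀ {j} → r′ ≤ punchIn i j ⇔ r ≤ j
        bp≤ = BlockPreserving-≤ bp

      SameBlock-punchIn : ∀ {j₁ j₂} → SameBlock r′ (punchIn i j₁) (punchIn i j₂) ⇔ SameBlock r j₁ j₂
      SameBlock-punchIn = mk⇔ (Sum.map (to bp) (to bp≤)) (Sum.map (from bp) (from bp≤))

      Occ3|12-punchIn : ∀ {j₁ j₂ j₃} →
                        Occ3|12 r′ z (punchIn i j₁) (punchIn i j₂) (punchIn i j₃) ⇔ Occ3|12 r w j₁ j₂ j₃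
      Occ3|12-punchIn = mk⇔
        (λ (occ3|12 a b c d e f) →
          let a′ = to bp a ; b′ = to bp≤ b ; c′ = punchIn-cancel-< i c ; d′ = to punchIn-<-length-⇔ d
              j₂<n = <-trans c′ d′ ; j₁<n = <-trans (<-≤-trans a′ b′) j₂<n
          in occ3|12 a′ b′ c′ d′ (to (at-punchIn-<-⇔ j₂<n d′) e) (to (at-punchIn-<-⇔ d′ j₁<n) f))
        (λ (occ3|12 a b c d e f) →
          let j₂<n = <-trans c d ; j₁<n = <-trans (<-≤-trans a b) j₂<n
          in occ3|12 (from bp a) (from bp≤ b) (punchIn-mono-< i c) (from punchIn-<-length-⇔ d)
                     (from (at-punchIn-<-⇔ j₂<n d) e) (from (at-punchIn-<-⇔ d j₁<n) f))

      Occ23|1-punchIn : ∀ {j₁ j₂ j₃} →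
                        Occ23|1 r′ z (punchIn i j₁) (punchIn i j₂) (punchIn i j₃) ⇔ Occ23|1 r w j₁ j₂ j₃
      Occ23|1-punchIn = mk⇔
        (λ (occ23|1 a b c d e f) →
          let a′ = punchIn-cancel-< i a ; b′ = to bp b ; c′ = to bp≤ c ; d′ = to punchIn-<-length-⇔ d
              j₂<n = <-≤-trans b′ (≤-trans c′ (<⇒≤ d′)) ; j₁<n = <-trans a′ j₂<n
          in occ23|1 a′ b′ c′ d′ (to (at-punchIn-<-⇔ d′ j₁<n) e) (to (at-punchIn-<-⇔ j₁<n j₂<n) f))
        (λ (occ23|1 a b c d e f) →
          let j₂<n = <-≤-trans b (≤-trans c (<⇒≤ d)) ; j₁<n = <-trans a j₂<n
          in occ23|1 (punchIn-mono-< i a) (from bp b) (from bp≤ c) (from punchIn-<-length-⇔ d)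
                     (from (at-punchIn-<-⇔ d j₁<n) e) (from (at-punchIn-<-⇔ j₁<n j₂<n) f))

      -- an occurrence in z that avoids position i comes from an occurrence in w
      Avoids-insertValue : (∀ {j₁ j₂ j₃} → Occ3|12 r′ z j₁ j₂ j₃ → j₁ ≢ i × j₂ ≢ i × j₃ ≢ i) →
                           (∀ {j₁ j₂ j₃} → Occ23|1 r′ z j₁ j₂ j₃ → j₁ ≢ i × j₂ ≢ i × j₃ ≢ i) →
                           Avoids r′ z ⇔ Avoids r w
      Avoids-insertValue away₃ away₂ = mk⇔
        (λ (no3|12 , no23|1) → (λ {_} {_} {_} o → no3|12 (from Occ3|12-punchIn o)) ,
                               (λ {_} {_} {_} o → no23|1 (from Occ23|1-punchIn o)))
        (λ (no3|12 , no23|1) →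
          (λ {_} {_} {_} o → let n₁ , n₂ , n₃ = away₃ o in
            no3|12 (to Occ3|12-punchIn (subst₃ (Occ3|12 r′ z) (unpunch n₁) (unpunch n₂) (unpunch n₃) o))) ,
          (λ {_} {_} {_} o → let n₁ , n₂ , n₃ = away₂ o in
            no23|1 (to Occ23|1-punchIn (subst₃ (Occ23|1 r′ z) (unpunch n₁) (unpunch n₂) (unpunch n₃) o))))
        where
        unpunch : ∀ {j} → j ≢ i → j ≡ punchIn i (punchOut i j)
        unpunch j≢i = sym (punchIn-punchOut j≢i)

  Avoids-insertMax : ∀ {n r i w} → IsPerm n w → r ≤ i → i ≤ n → Avoids r (insertValue i n w) ⇔ Avoids r w
  Avoids-insertMax {n} {r} {i} {w} pw r≤i i≤n = Avoids-insertValue (blockPreserving-right r≤i) away₃ away₂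
    where
    i≤∣w∣ : i ≤ length w
    i≤∣w∣ = subst (i ≤_) (sym (length≡ pw)) i≤n
    open InsertValue {v = n} {w} i≤∣w∣ using (z; Avoids-insertValue)
    n≮ : ∀ {j} → j < length z → ¬ (at z i < at z j)
    n≮ {j} j<n lt = <⇒≱ (subst (_< at z j) (at-insertValue i≤∣w∣) lt)
                        (≤-pred (IsPerm-at-< (IsPerm-insertValue i ≤-refl pw) j<n))
    left≢ : ∀ {j} → j < r → j ≢ i
    left≢ j<r refl = <⇒≱ j<r r≤i
    away₃ : ∀ {j₁ j₂ j₃} → Occ3|12 r z j₁ j₂ j₃ → j₁ ≢ i × j₂ ≢ i × j₃ ≢ i
    away₃ (occ3|12 a b c d e f) =
      left≢ a , (λ { refl → n≮ d e }) , (λ { refl → n≮ (<-trans (<-≤-trans a b) (<-trans c d)) f })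
    away₂ : ∀ {j₁ j₂ j₃} → Occ23|1 r z j₁ j₂ j₃ → j₁ ≢ i × j₂ ≢ i × j₃ ≢ i
    away₂ (occ23|1 a b c d e f) =
      left≢ (<-trans a b) , left≢ b , (λ { refl → n≮ (<-trans a (<-≤-trans b (≤-trans c (<⇒≤ d)))) e })

  Avoids-insertMin : ∀ {r i w} → i ≤ r → i ≤ length w → Avoids (suc r) (insertValue i 0 w) ⇔ Avoids r w
  Avoids-insertMin {r} {i} {w} i≤r i≤∣w∣ = Avoids-insertValue (blockPreserving-left i≤r) away₃ away₂
    where
    open InsertValue {v = 0} {w} i≤∣w∣ using (z; Avoids-insertValue)
    ≮0 : ∀ {j} → ¬ (at z j < at z i)
    ≮0 {j} lt = n≮0 (subst (at z j <_) (at-insertValue i≤∣w∣) lt)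
    right≢ : ∀ {j} → suc r ≤ j → j ≢ i
    right≢ r<j refl = <⇒≱ (s≤s i≤r) r<j
    away₃ : ∀ {j₁ j₂ j₃} → Occ3|12 (suc r) z j₁ j₂ j₃ → j₁ ≢ i × j₂ ≢ i × j₃ ≢ i
    away₃ (occ3|12 a b c d e f) = (λ { refl → ≮0 f }) , right≢ b , right≢ (≤-trans b (<⇒≤ c))
    away₂ : ∀ {j₁ j₂ j₃} → Occ23|1 (suc r) z j₁ j₂ j₃ → j₁ ≢ i × j₂ ≢ i × j₃ ≢ i
    away₂ (occ23|1 a b c d e f) = (λ { refl → ≮0 e }) , (λ { refl → ≮0 f }) , right≢ c

  -- weakly decreasing on both blocks, which for a permutation is the same as decreasing
  NonIncreasingOnBlocks : ℕ → List ℕ → Set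
  NonIncreasingOnBlocks r w = ∀ {j₂} → j₂ < length w → ∀ {j₁} → j₁ < j₂ → SameBlock r j₁ j₂ → at w j₂ ≤ at w j₁

  nonIncreasingOnBlocks? : ∀ r → Decidable (NonIncreasingOnBlocks r)
  nonIncreasingOnBlocks? r w = allUpTo?
    (λ j₂ → allUpTo? (λ j₁ → ((j₂ <? r) ⊎-dec (r ≤? j₁)) →-dec (at w j₂ ≤? at w j₁)) j₂) (length w)

  NonIncreasingOnBlocks-insertMax : ∀ {n r r′ i w} → IsPerm n w → i ≤ n → BlockPreserving i r r′ →
    (∀ {j} → j < i → ¬ SameBlock r′ j i) →
    NonIncreasingOnBlocks r′ (insertValue i n w) ⇔ NonIncreasingOnBlocks r w
  NonIncreasingOnBlocks-insertMax {n} {r} {r′} {i} {w} pw i≤n bp block-start = mk⇔ restrict extend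
    where
    i≤∣w∣ : i ≤ length w
    i≤∣w∣ = subst (i ≤_) (sym (length≡ pw)) i≤n
    open InsertValue {v = n} {w} i≤∣w∣ using (z; at-punchIn-≤-⇔; punchIn-<-length-⇔; SameBlock-punchIn)
    restrict : NonIncreasingOnBlocks r′ z → NonIncreasingOnBlocks r w
    restrict ni j₂<n j₁<j₂ sb = to (at-punchIn-≤-⇔ j₂<n (<-trans j₁<j₂ j₂<n))
      (ni (from punchIn-<-length-⇔ j₂<n) (punchIn-mono-< i j₁<j₂) (from (SameBlock-punchIn bp) sb))
    extend : NonIncreasingOnBlocks r w → NonIncreasingOnBlocks r′ z
    extend ni {j₂} j₂<n {j₁} j₁<j₂ sb with j₂ ≟ i | j₁ ≟ i
    ... | yes refl | _        = ⊥-elim (block-start j₁<j₂ sb)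
    ... | no _     | yes refl = subst (at z j₂ ≤_) (sym (at-insertValue i≤∣w∣))
                                  (≤-pred (IsPerm-at-< (IsPerm-insertValue i ≤-refl pw) j₂<n))
    ... | no j₂≢i  | no j₁≢i  = subst₂ (λ a b → at z a ≤ at z b) (punchIn-punchOut j₂≢i) (punchIn-punchOut j₁≢i)
      (from (at-punchIn-≤-⇔ j₂′<n (<-trans j₁′<j₂′ j₂′<n)) (ni j₂′<n j₁′<j₂′ (to (SameBlock-punchIn bp) sb′)))
      where
      e₁ : j₁ ≡ punchIn i (punchOut i j₁)
      e₁ = sym (punchIn-punchOut j₁≢i)
      e₂ : j₂ ≡ punchIn i (punchOut i j₂)
      e₂ = sym (punchIn-punchOut j₂≢i)
      j₂′<n : punchOut i j₂ < length w
      j₂′<n = to punchIn-<-length-⇔ (subst (_< length z) e₂ j₂<n)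
      j₁′<j₂′ : punchOut i j₁ < punchOut i j₂
      j₁′<j₂′ = punchIn-cancel-< i (subst₂ _<_ e₁ e₂ j₁<j₂)
      sb′ : SameBlock r′ (punchIn i (punchOut i j₁)) (punchIn i (punchOut i j₂))
      sb′ = subst₂ (SameBlock r′) e₁ e₂ sb

  -- An ascent in the left block would form 23|1 with the minimum,
  -- one in the right block 3|12 with the maximum in front.
  Avoids-max∷⇔ : ∀ {n r w} → IsPerm n w → r ≤ indexOf 0 w → Avoids (suc r) (n ∷ w) ⇔ NonIncreasingOnBlocks r w
  Avoids-max∷⇔ {n} {r} {w} pw r≤q = mk⇔ to-ni from-ni
    where
    q : ℕ
    q = indexOf 0 w
    to-ni : Avoids (suc r) (n ∷ w) → NonIncreasingOnBlocks r w
    to-ni (no3|12 , _) j₂<n j₁<j₂ (inj₂ r≤j₁) = ≮⇒≥ λ w₁<w₂ →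
      no3|12 (occ3|12 (s≤s z≤n) (s≤s r≤j₁) (s≤s j₁<j₂) (s≤s j₂<n) w₁<w₂ (IsPerm-at-< pw j₂<n))
    to-ni (_ , no23|1) {j₂} j₂<n {j₁} j₁<j₂ (inj₁ j₂<r) = ≮⇒≥ λ w₁<w₂ →
      no23|1 (occ23|1 (s≤s j₁<j₂) (s≤s j₂<r) (s≤s r≤q) (s≤s (indexOf-< 0∈w)) wq<w₁ w₁<w₂)
      where
      0∈w : 0 ∈ w
      0∈w = IsPerm-∋ pw (subst (0 <_) (length≡ pw) (≤-<-trans z≤n j₂<n))
      wq<w₁ : at w q < at w j₁
      wq<w₁ = subst (_< at w j₁) (sym (at-indexOf 0∈w))
        (n≢0⇒n>0 (at-before-indexOf {w = w} (<-≤-trans (<-trans j₁<j₂ j₂<r) r≤q)))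
    from-ni : NonIncreasingOnBlocks r w → Avoids (suc r) (n ∷ w)
    from-ni ni = no3|12 , no23|1
      where
      no3|12 : ∀ {j₁ j₂ j₃} → ¬ Occ3|12 (suc r) (n ∷ w) j₁ j₂ j₃
      no3|12 {j₂ = zero}          (occ3|12 _ () _ _ _ _)
      no3|12 {j₂ = suc _} {zero}  (occ3|12 _ _ () _ _ _)
      no3|12 {j₂ = suc _} {suc _} (occ3|12 _ (s≤s r≤j₂) (s≤s j₂<j₃) (s≤s j₃<n) w₂<w₃ _) =
        <⇒≱ w₂<w₃ (ni j₃<n j₂<j₃ (inj₂ r≤j₂))
      no23|1 : ∀ {j₁ j₂ j₃} → ¬ Occ23|1 (suc r) (n ∷ w) j₁ j₂ j₃
      no23|1 {j₂ = zero} (occ23|1 () _ _ _ _ _)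
      no23|1 {j₃ = zero} (occ23|1 _ _ () _ _ _)
      no23|1 {zero}  {suc _} {suc _} (occ23|1 _ (s≤s j₂<r) (s≤s r≤j₃) (s≤s j₃<n) _ n<w₂) =
        <⇒≱ n<w₂ (<⇒≤ (IsPerm-at-< pw (<-≤-trans j₂<r (≤-trans r≤j₃ (<⇒≤ j₃<n)))))
      no23|1 {suc _} {suc _} {suc _} (occ23|1 (s≤s j₁<j₂) (s≤s j₂<r) (s≤s r≤j₃) (s≤s j₃<n) _ w₁<w₂) =
        <⇒≱ w₁<w₂ (ni (<-≤-trans j₂<r (≤-trans r≤j₃ (<⇒≤ j₃<n))) j₁<j₂ (inj₁ j₂<r))

  indexOf-max-avoider : ∀ {n r z} → IsPerm (suc n) z → Avoids (suc r) z →
                        indexOf n z < suc r → suc r ≤ indexOf 0 z → indexOf n z ≡ 0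
  indexOf-max-avoider {n} {r} {z} pz (_ , no23|1) p<R R≤q with indexOf n z in p≡
  ... | zero  = refl
  ... | suc p = ⊥-elim (no23|1 (occ23|1 (s≤s z≤n) p<R R≤q (indexOf-< 0∈z) zq<z₀ z₀<zp))
    where
    0∈z : 0 ∈ z
    0∈z = IsPerm-∋ pz (s≤s z≤n)
    n∈z : n ∈ z
    n∈z = IsPerm-∋ pz ≤-refl
    zq<z₀ : at z (indexOf 0 z) < at z 0
    zq<z₀ = subst (_< at z 0) (sym (at-indexOf 0∈z)) (n≢0⇒n>0 (at-before-indexOf {w = z} (<-≤-trans (s≤s z≤n) R≤q)))
    z₀<zp : at z 0 < at z (suc p)
    z₀<zp = subst (at z 0 <_) (trans (sym (at-indexOf n∈z)) (cong (at z) p≡))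
      (≤∧≢⇒< (≤-pred (IsPerm-at-< pz (<-trans (s≤s z≤n) (subst (_< length z) p≡ (indexOf-< n∈z)))))
             (at-before-indexOf {w = z} (subst (0 <_) (sym p≡) (s≤s z≤n))))

  indexOf-max-nonIncreasing : ∀ {n r z} → IsPerm (suc n) z → NonIncreasingOnBlocks r z →
                              indexOf n z ≡ 0 ⊎ indexOf n z ≡ r
  indexOf-max-nonIncreasing {n} {r} {z} pz ni = go (indexOf n z) refl
    where
    n∈z : n ∈ z
    n∈z = IsPerm-∋ pz ≤-refl
    p<∣z∣ : indexOf n z < length z
    p<∣z∣ = indexOf-< n∈z
    starts-block : ∀ {j} → j < indexOf n z → ¬ SameBlock r j (indexOf n z)
    starts-block {j} j<p sb = at-before-indexOf {w = z} j<p (≤-antisym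
      (≤-pred (IsPerm-at-< pz (<-trans j<p p<∣z∣)))
      (subst (_≤ at z j) (at-indexOf n∈z) (ni p<∣z∣ j<p sb)))
    go : ∀ p → indexOf n z ≡ p → p ≡ 0 ⊎ p ≡ r
    go zero    _  = inj₁ refl
    go (suc p) p≡ with <-cmp (suc p) r
    ... | tri< p<r _ _ = ⊥-elim (starts-block (subst (p <_) (sym p≡) ≤-refl) (inj₁ (subst (_< r) (sym p≡) p<r)))
    ... | tri≈ _ p≡r _ = inj₂ p≡r
    ... | tri> _ _ r<p = ⊥-elim (starts-block (subst (p <_) (sym p≡) ≤-refl) (inj₂ (≤-pred r<p)))

  -- The four classes of avoiders

  InRightBlock : ℕ → ℕ → List ℕ → Set
  InRightBlock r v z = r ≤ indexOf v z

  inRightBlock? : ∀ r v → Decidable (InRightBlock r v)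
  inRightBlock? r v z = r ≤? indexOf v z

  BlockDecreasing : ℕ → List ℕ → Set
  BlockDecreasing r z = NonIncreasingOnBlocks r z × InRightBlock r 0 z

  blockDecreasing? : ∀ r → Decidable (BlockDecreasing r)
  blockDecreasing? r = nonIncreasingOnBlocks? r ∩? inRightBlock? r 0

  blockDecreasingCount : ℕ → ℕ → ℕ
  blockDecreasingCount r t = count (blockDecreasing? r) (r + t)

  InRightBlock-0-insertValue : ∀ {i r r′ v w} → 0 < v → i ≤ length w → BlockPreserving i r r′ →
                               InRightBlock r′ 0 (insertValue i v w) ⇔ InRightBlock r 0 w
  InRightBlock-0-insertValue {i} {r} {r′} {v} {w} 0<v i≤∣w∣ bp =
    subst (λ p → (r′ ≤ p) ⇔ InRightBlock r 0 w) (sym q≡) (BlockPreserving-≤ bp)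
    where
    q≡ : indexOf 0 (insertValue i v w) ≡ punchIn i (indexOf 0 w)
    q≡ = trans (cong (λ y → indexOf y (insertValue i v w)) (sym (punchIn-below 0<v)))
               (indexOf-insertValue-punchIn i≤∣w∣ 0)

  count-maxInRightBlock : ∀ {P : Pred (List ℕ) 0ℓ} (P? : Decidable P) r s {n} → r + s ≡ n →
    (∀ {w i} → IsPerm n w → r ≤ i → i ≤ n → P (insertValue i n w) ⇔ P w) →
    count (P? ∩? inRightBlock? r n) (suc n) ≡ suc s * count P? n
  count-maxInRightBlock {P} P? r s refl P-insert =
    count-insertValue P? (P? ∩? inRightBlock? r n) ≤-refl (≤-reflexive (+-suc r s)) insert⇔ window
    where
    n = r + s
    insert⇔ : ∀ {w i} → IsPerm n w → i < suc s →
              (P (insertValue (r + i) n w) × InRightBlock r n (insertValue (r + i) n w)) ⇔ P w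
    insert⇔ {w} {i} pw i<S = mk⇔ (to P⇔ ∘ proj₁) λ Pw → from P⇔ Pw ,
      subst (r ≤_) (sym (indexOf-insertValue (subst (r + i ≤_) (sym (length≡ pw)) r+i≤n))) (m≤m+n r i)
      where
      r+i≤n : r + i ≤ n
      r+i≤n = +-monoʳ-≤ r (≤-pred i<S)
      P⇔ : P (insertValue (r + i) n w) ⇔ P w
      P⇔ = P-insert pw (m≤m+n r i) r+i≤n
    window : ∀ {z} → IsPerm (suc n) z → P z × InRightBlock r n z → r ≤ indexOf n z × indexOf n z < r + suc s
    window {z} pz (_ , r≤p) =
      r≤p , subst (indexOf n z <_) (trans (length≡ pz) (sym (+-suc r s))) (indexOf-< (IsPerm-∋ pz ≤-refl))

  count-avoiders-maxRight : ∀ r s {n} → r + s ≡ n → count (avoids? r ∩? inRightBlock? r n) (suc n) ≡ suc s * k r n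
  count-avoiders-maxRight r s n≡ =
    count-maxInRightBlock (avoids? r) r s n≡ λ pw r≤i i≤n → avoids-cong (Avoids-insertMax pw r≤i i≤n)

  count-avoiders-minLeft : ∀ r t →
    count (avoids? (suc r) ∩? ∁? (inRightBlock? (suc r) 0)) (suc (r + t)) ≡ suc r * k r (r + t)
  count-avoiders-minLeft r t =
    count-insertValue (avoids? r) (avoids? (suc r) ∩? ∁? (inRightBlock? (suc r) 0)) z≤n (s≤s (m≤m+n r t)) insert⇔ window
    where
    insert⇔ : ∀ {w i} → IsPerm (r + t) w → i < suc r →
      (avoids (suc r) (insertValue i 0 w) ≡ true × ¬ InRightBlock (suc r) 0 (insertValue i 0 w)) ⇔ (avoids r w ≡ true)
    insert⇔ {w} {i} pw i<R = mk⇔ (to av⇔ ∘ proj₁)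
      λ a → from av⇔ a , <⇒≱ (subst (_< suc r) (sym (indexOf-insertValue i≤∣w∣)) i<R)
      where
      i≤∣w∣ : i ≤ length w
      i≤∣w∣ = subst (i ≤_) (sym (length≡ pw)) (≤-trans (≤-pred i<R) (m≤m+n r t))
      av⇔ : (avoids (suc r) (insertValue i 0 w) ≡ true) ⇔ (avoids r w ≡ true)
      av⇔ = avoids-cong (Avoids-insertMin (≤-pred i<R) i≤∣w∣)
    window : ∀ {z} → IsPerm (suc (r + t)) z → avoids (suc r) z ≡ true × ¬ InRightBlock (suc r) 0 z →
             0 ≤ indexOf 0 z × indexOf 0 z < suc r
    window _ (_ , minLeft) = z≤n , ≰⇒> minLeft

  count-avoiders-minLeft-maxRight : ∀ r s {n} → suc r + s ≡ n →
    count ((avoids? (suc r) ∩? ∁? (inRightBlock? (suc r) 0)) ∩? inRightBlock? (suc r) n) (suc n)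
    ≡ suc s * count (avoids? (suc r) ∩? ∁? (inRightBlock? (suc r) 0)) n
  count-avoiders-minLeft-maxRight r s refl = count-maxInRightBlock _ (suc r) s refl
    λ {w} {i} pw R≤i i≤n → avoids-cong (Avoids-insertMax pw R≤i i≤n) ×-⇔
      ¬-cong-⇔ (InRightBlock-0-insertValue {w = w} (s≤s z≤n) (subst (i ≤_) (sym (length≡ pw)) i≤n)
                                           (blockPreserving-right R≤i))

  count-avoiders-maxLeft-minRight : ∀ r s →
    count ((avoids? (suc r) ∩? ∁? (inRightBlock? (suc r) (r + suc s))) ∩? inRightBlock? (suc r) 0) (suc (r + suc s))
    ≡ blockDecreasingCount r (suc s)
  count-avoiders-maxLeft-minRight r s = trans
    (count-insertValue (blockDecreasing? r) _ {n} {n} {0} {1} ≤-refl (s≤s z≤n) insert⇔ window)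
    (+-identityʳ _)
    where
    n = r + suc s
    insert⇔ : ∀ {w i} → IsPerm n w → i < 1 →
      ((avoids (suc r) (insertValue i n w) ≡ true × ¬ InRightBlock (suc r) n (insertValue i n w)) ×
        InRightBlock (suc r) 0 (insertValue i n w)) ⇔ BlockDecreasing r w
    insert⇔ {w} {zero} pw _ = mk⇔
      (λ ((a , _) , m) → let m′ = to min⇔ m in
        to (Avoids-max∷⇔ pw m′) (subst (Avoids (suc r)) z≡ (to avoids≡true⇔ a)) , m′)
      (λ (ni , m′) → (from avoids≡true⇔ (subst (Avoids (suc r)) (sym z≡) (from (Avoids-max∷⇔ pw m′) ni)) ,
                      λ R≤p → <⇒≱ (s≤s z≤n) (subst (suc r ≤_) (indexOf-insertValue z≤n) R≤p)) ,
                     from min⇔ m′)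
      where
      z≡ : insertValue 0 n w ≡ n ∷ w
      z≡ = cong (n ∷_) (map-punchIn-below (bounded pw))
      min⇔ : InRightBlock (suc r) 0 (insertValue 0 n w) ⇔ InRightBlock r 0 w
      min⇔ = InRightBlock-0-insertValue {i = 0} (subst (0 <_) (sym (+-suc r s)) (s≤s z≤n)) z≤n
                                        (blockPreserving-left z≤n)
    insert⇔ {i = suc _} _ (s≤s ())
    window : ∀ {z} → IsPerm (suc n) z →
      (avoids (suc r) z ≡ true × ¬ InRightBlock (suc r) n z) × InRightBlock (suc r) 0 z →
      0 ≤ indexOf n z × indexOf n z < 1
    window pz ((a , maxLeft) , minRight) =
      z≤n , subst (_< 1) (sym (indexOf-max-avoider pz (to avoids≡true⇔ a) (≰⇒> maxLeft) minRight)) (s≤s z≤n)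

  BlockDecreasing-insertMax : ∀ {n r r′ i w} → IsPerm n w → 0 < n → i ≤ n → BlockPreserving i r r′ →
    (∀ {j} → j < i → ¬ SameBlock r′ j i) → BlockDecreasing r′ (insertValue i n w) ⇔ BlockDecreasing r w
  BlockDecreasing-insertMax {i = i} pw 0<n i≤n bp block-start =
    NonIncreasingOnBlocks-insertMax pw i≤n bp block-start ×-⇔
    InRightBlock-0-insertValue 0<n (subst (i ≤_) (sym (length≡ pw)) i≤n) bp

  blockDecreasingCount-0 : ∀ t → blockDecreasingCount 0 t ≡ 1
  blockDecreasingCount-0 zero    = refl
  blockDecreasingCount-0 (suc t) = trans
    (count-insertValue (blockDecreasing? 0) (blockDecreasing? 0) {t} {t} {0} {1} ≤-refl (s≤s z≤n) insert⇔ window)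
    (trans (+-identityʳ _) (blockDecreasingCount-0 t))
    where
    insert⇔ : ∀ {w i} → IsPerm t w → i < 1 → BlockDecreasing 0 (insertValue i t w) ⇔ BlockDecreasing 0 w
    insert⇔ {i = zero} pw _ =
      NonIncreasingOnBlocks-insertMax pw z≤n (blockPreserving-right {i = 0} z≤n) (λ ()) ×-⇔ mk⇔ (λ _ → z≤n) (λ _ → z≤n)
    insert⇔ {i = suc _} _ (s≤s ())
    window : ∀ {z} → IsPerm (suc t) z → BlockDecreasing 0 z → 0 ≤ indexOf t z × indexOf t z < 1
    window pz (ni , _) with indexOf-max-nonIncreasing pz ni
    ... | inj₁ p≡0 = z≤n , subst (_< 1) (sym p≡0) (s≤s z≤n)
    ... | inj₂ p≡0 = z≤n , subst (_< 1) (sym p≡0) (s≤s z≤n)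

  blockDecreasingCount-emptyRight : ∀ r → blockDecreasingCount (suc r) 0 ≡ 0
  blockDecreasingCount-emptyRight r = count-none (blockDecreasing? (suc r)) {suc r + 0} λ {z} pz (_ , R≤q) →
    <⇒≱ (subst (indexOf 0 z <_) (trans (length≡ pz) (+-identityʳ (suc r))) (indexOf-< (IsPerm-∋ pz (s≤s z≤n)))) R≤q

  blockDecreasingCount-maxLeft : ∀ r s →
    count (blockDecreasing? (suc r) ∩? ∁? (inRightBlock? (suc r) (r + suc s))) (suc (r + suc s))
    ≡ blockDecreasingCount r (suc s)
  blockDecreasingCount-maxLeft r s = trans
    (count-insertValue (blockDecreasing? r) _ {n} {n} {0} {1} ≤-refl (s≤s z≤n) insert⇔ window)
    (+-identityʳ _)
    where
    n = r + suc s
    insert⇔ : ∀ {w i} → IsPerm n w → i < 1 →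
      (BlockDecreasing (suc r) (insertValue i n w) × ¬ InRightBlock (suc r) n (insertValue i n w)) ⇔ BlockDecreasing r w
    insert⇔ {w} {zero} pw _ = mk⇔ (to main ∘ proj₁)
      λ bd → from main bd , λ R≤p → <⇒≱ (s≤s z≤n) (subst (suc r ≤_) (indexOf-insertValue z≤n) R≤p)
      where
      main : BlockDecreasing (suc r) (insertValue 0 n w) ⇔ BlockDecreasing r w
      main = BlockDecreasing-insertMax pw (subst (0 <_) (sym (+-suc r s)) (s≤s z≤n)) z≤n
                                       (blockPreserving-left {i = 0} z≤n) (λ ())
    insert⇔ {i = suc _} _ (s≤s ())
    window : ∀ {z} → IsPerm (suc n) z → BlockDecreasing (suc r) z × ¬ InRightBlock (suc r) n z →
             0 ≤ indexOf n z × indexOf n z < 1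
    window pz ((ni , _) , maxLeft) with indexOf-max-nonIncreasing pz ni
    ... | inj₁ p≡0 = z≤n , subst (_< 1) (sym p≡0) (s≤s z≤n)
    ... | inj₂ p≡R = ⊥-elim (maxLeft (≤-reflexive (sym p≡R)))

  blockDecreasingCount-maxRight : ∀ r s →
    count (blockDecreasing? (suc r) ∩? inRightBlock? (suc r) (r + suc s)) (suc (r + suc s))
    ≡ blockDecreasingCount (suc r) s
  blockDecreasingCount-maxRight r s = trans
    (count-insertValue (blockDecreasing? R) _ {n} {n} {R} {1} ≤-refl (s≤s (+-monoʳ-≤ r (s≤s z≤n))) insert⇔ window)
    (trans (+-identityʳ _) (cong (count (blockDecreasing? R)) (+-suc r s)))
    where
    R = suc r
    n = r + suc s
    R+0≤n : R + 0 ≤ n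
    R+0≤n = subst₂ _≤_ (sym (+-identityʳ R)) (sym (+-suc r s)) (s≤s (m≤m+n r s))
    block-start : ∀ {j} → j < R + 0 → ¬ SameBlock R j (R + 0)
    block-start _       (inj₁ R<R) = <-irrefl (+-identityʳ R) R<R
    block-start {j} j<R (inj₂ R≤j) = <⇒≱ (subst (j <_) (+-identityʳ R) j<R) R≤j
    insert⇔ : ∀ {w i} → IsPerm n w → i < 1 →
      (BlockDecreasing R (insertValue (R + i) n w) × InRightBlock R n (insertValue (R + i) n w)) ⇔ BlockDecreasing R w
    insert⇔ {w} {zero} pw _ = mk⇔ (to main ∘ proj₁) λ bd → from main bd ,
      ≤-reflexive (sym (trans (indexOf-insertValue {v = n} {w} (subst (R + 0 ≤_) (sym (length≡ pw)) R+0≤n))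
                              (+-identityʳ R)))
      where
      main : BlockDecreasing R (insertValue (R + 0) n w) ⇔ BlockDecreasing R w
      main = BlockDecreasing-insertMax pw (≤-trans (s≤s z≤n) R+0≤n) R+0≤n
                                       (blockPreserving-right (m≤m+n R 0)) block-start
    insert⇔ {i = suc _} _ (s≤s ())
    window : ∀ {z} → IsPerm (suc n) z → BlockDecreasing R z × InRightBlock R n z → R ≤ indexOf n z × indexOf n z < R + 1
    window pz ((ni , _) , R≤p) with indexOf-max-nonIncreasing pz ni
    ... | inj₁ p≡0 = ⊥-elim (<⇒≱ (s≤s z≤n) (subst (R ≤_) p≡0 R≤p))
    ... | inj₂ p≡R = R≤p , subst (_< R + 1) (sym p≡R) (subst (R <_) (+-comm 1 R) ≤-refl)

  -- the maximum starts the left or the right block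
  blockDecreasingCount-split : ∀ r s →
    blockDecreasingCount (suc r) (suc s) ≡ blockDecreasingCount r (suc s) + blockDecreasingCount (suc r) s
  blockDecreasingCount-split r s = begin
    count P? (suc n)                                              ≡⟨ count-split P? MaxR? (suc n) ⟩
    count (P? ∩? MaxR?) (suc n) + count (P? ∩? ∁? MaxR?) (suc n)   ≡⟨ +-comm (count (P? ∩? MaxR?) (suc n)) _ ⟩
    count (P? ∩? ∁? MaxR?) (suc n) + count (P? ∩? MaxR?) (suc n)   ≡⟨ cong₂ _+_ (blockDecreasingCount-maxLeft r s)
                                                                                (blockDecreasingCount-maxRight r s) ⟩
    blockDecreasingCount r (suc s) + blockDecreasingCount (suc r) s ∎
    where
    open ≡-Reasoning
    n = r + suc s
    P? = blockDecreasing? (suc r)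
    MaxR? = inRightBlock? (suc r) n

  blockDecreasingCount≡C : ∀ r s → blockDecreasingCount r (suc s) ≡ (r + s) C r
  blockDecreasingCount≡C zero    s       = blockDecreasingCount-0 (suc s)
  blockDecreasingCount≡C (suc r) zero    = begin
    blockDecreasingCount (suc r) 1                            ≡⟨ blockDecreasingCount-split r 0 ⟩
    blockDecreasingCount r 1 + blockDecreasingCount (suc r) 0 ≡⟨ cong₂ _+_ (blockDecreasingCount≡C r 0)
                                                                            (blockDecreasingCount-emptyRight r) ⟩
    (r + 0) C r + 0                                           ≡⟨ +-identityʳ _ ⟩
    (r + 0) C r                                               ≡⟨ cong (_C r) (+-identityʳ r) ⟩
    r C r                                                     ≡⟨ trans (nCn≡1 r) (sym (nCn≡1 (suc r))) ⟩
    suc r C suc r                                             ≡⟨ cong (_C suc r) (+-identityʳ (suc r)) ⟨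
    (suc r + 0) C suc r                                       ∎
    where open ≡-Reasoning
  blockDecreasingCount≡C (suc r) (suc s) = begin
    blockDecreasingCount (suc r) (suc (suc s))
      ≡⟨ blockDecreasingCount-split r (suc s) ⟩
    blockDecreasingCount r (suc (suc s)) + blockDecreasingCount (suc r) (suc s)
      ≡⟨ cong₂ _+_ (blockDecreasingCount≡C r (suc s)) (blockDecreasingCount≡C (suc r) s) ⟩
    (r + suc s) C r + (suc r + s) C suc r
      ≡⟨ cong (λ m → (r + suc s) C r + m C suc r) (+-suc r s) ⟨
    (r + suc s) C r + (r + suc s) C suc r
      ≡⟨ nCk+nC[k+1]≡[n+1]C[k+1] (r + suc s) r ⟩
    (suc r + suc s) C suc r
      ∎
    where open ≡-Reasoning

  k-recurrence : ∀ r s → k (suc r) (suc r + suc s) + suc s * (suc r * k r (r + s))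
                         ≡ suc s * k (suc r) (suc r + s) + suc r * k r (r + suc s) + (r + s) C r
  k-recurrence r s = begin
    count Av (suc n) + suc s * (R * k r (r + s))                     ≡⟨ cong (count Av (suc n) +_) both ⟨
    count Av (suc n) + count ((Av ∩? ∁? MinR) ∩? MaxR) (suc n)
      ≡⟨ count-inclusion-exclusion Av MaxR MinR (suc n) ⟩
    count (Av ∩? MaxR) (suc n) + count (Av ∩? ∁? MinR) (suc n) + count ((Av ∩? ∁? MaxR) ∩? MinR) (suc n)
      ≡⟨ cong₂ _+_ (cong₂ _+_ maxRight (count-avoiders-minLeft r (suc s))) maxLeft-minRight ⟩
    suc s * k R (R + s) + R * k r n + (r + s) C r ∎
    where
    open ≡-Reasoning
    R = suc r
    n = r + suc s
    Av = avoids? R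
    MaxR = inRightBlock? R n
    MinR = inRightBlock? R 0
    maxRight : count (Av ∩? MaxR) (suc n) ≡ suc s * k R (R + s)
    maxRight = trans (count-avoiders-maxRight R s (sym (+-suc r s))) (cong (λ m → suc s * k R m) (+-suc r s))
    both : count ((Av ∩? ∁? MinR) ∩? MaxR) (suc n) ≡ suc s * (R * k r (r + s))
    both = trans (count-avoiders-minLeft-maxRight r s (sym (+-suc r s)))
      (cong (suc s *_) (trans (cong (count (Av ∩? ∁? MinR)) (+-suc r s)) (count-avoiders-minLeft r s)))
    maxLeft-minRight : count ((Av ∩? ∁? MaxR) ∩? MinR) (suc n) ≡ (r + s) C r
    maxLeft-minRight = trans (count-avoiders-maxLeft-minRight r s) (blockDecreasingCount≡C r s)

-- Fractions

open Combinatorics using (k-boundaryʳ; k-boundaryˡ; k-recurrence)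

open import Data.Integer using (+_) renaming (_*_ to _ℤ*_; _+_ to _ℤ+_)
open import Data.Integer.Properties using (pos-*; pos-+)
import Data.Integer.Solver as ℤ-Solver
open import Data.Nat using (ℕ; suc; _*_; _!; NonZero) renaming (_+_ to _ℕ+_)
open import Data.Nat.Combinatorics using (_C_)
open import Data.Nat.Properties using (_!*_!≢0; *-comm; *-identityˡ; *-identityʳ)
import Data.Nat.Solver as ℕ-Solver
open import Data.Product using (_×_; _,_)
open import Data.Rational using (0ℚ; 1ℚ; _/_; _+_; _-_)
open import Data.Rational.Properties using (toℚᵘ-injective; toℚᵘ-homo-+; toℚᵘ-fromℚᵘ; fromℚᵘ-cong; +-inverseʳ)
import Data.Rational.Solver as ℚ-Solver
open import Data.Rational.Unnormalised using (mkℚᵘ; *≡*)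
open import Data.Rational.Unnormalised.Properties using (≃-trans; ≃-sym) renaming (+-cong to +ᵘ-cong)
open import Relation.Binary.PropositionalEquality using (_≡_; refl; sym; trans; cong; cong₂; module ≡-Reasoning)

m/d≡m′/d′ : ∀ m d m′ d′ .{{_ : NonZero d}} .{{_ : NonZero d′}} → m * d′ ≡ m′ * d → (+ m) / d ≡ (+ m′) / d′
m/d≡m′/d′ m (suc d) m′ (suc d′) eq = fromℚᵘ-cong {mkℚᵘ (+ m) d} {mkℚᵘ (+ m′) d′}
  (*≡* (trans (sym (pos-* m (suc d′))) (trans (cong +_ eq) (pos-* m′ (suc d)))))

m/d+m′/d≡[m+m′]/d : ∀ m m′ d .{{_ : NonZero d}} → (+ m) / d + (+ m′) / d ≡ (+ (m ℕ+ m′)) / d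
m/d+m′/d≡[m+m′]/d m m′ d@(suc d₀) = toℚᵘ-injective (≃-trans (toℚᵘ-homo-+ ((+ m) / d) ((+ m′) / d))
  (≃-trans (+ᵘ-cong (toℚᵘ-fromℚᵘ (mkℚᵘ (+ m) d₀)) (toℚᵘ-fromℚᵘ (mkℚᵘ (+ m′) d₀)))
  (≃-trans (*≡* cross) (≃-sym (toℚᵘ-fromℚᵘ (mkℚᵘ (+ (m ℕ+ m′)) d₀))))))
  where
  open ℤ-Solver.+-*-Solver using (solve; _:+_; _:*_; _:=_)
  cross : ((+ m) ℤ* (+ d) ℤ+ (+ m′) ℤ* (+ d)) ℤ* (+ d) ≡ (+ (m ℕ+ m′)) ℤ* (+ (d * d))
  cross = trans (solve 3 (λ x y z → (x :* z :+ y :* z) :* z := (x :+ y) :* (z :* z)) refl (+ m) (+ m′) (+ d))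
                (sym (cong₂ _ℤ*_ (pos-+ m m′) (pos-* d d)))

a-boundary : ∀ {K d} .{{_ : NonZero d}} → K ≡ d → (+ K) / d - 1ℚ ≡ 0ℚ
a-boundary {d = d} refl = trans (cong (_- 1ℚ) (m/d≡m′/d′ d d 1 1 (*-comm d 1))) (+-inverseʳ 1ℚ)

common-denominator-sum : ∀ r s {K K₁ K₂ K₀ c} →
  K ℕ+ suc s * (suc r * K₀) ≡ suc s * K₁ ℕ+ suc r * K₂ ℕ+ c →
  ((+ K) / (suc r ! * suc s !)) {{suc r !* suc s !≢0}} + ((+ K₀) / (r ! * s !)) {{r !* s !≢0}}
    ≡ (((+ K₁) / (suc r ! * s !)) {{suc r !* s !≢0}} + ((+ K₂) / (r ! * suc s !)) {{r !* suc s !≢0}})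
      + ((+ c) / (suc r ! * suc s !)) {{suc r !* suc s !≢0}}
common-denominator-sum r s {K} {K₁} {K₂} {K₀} {c} eq = begin
  (+ K) / D + (+ K₀) / (r ! * s !)
    ≡⟨ cong (λ t → (+ K) / D + t) (m/d≡m′/d′ K₀ (r ! * s !) (S * (R * K₀)) D (cross₀ K₀ R (r !) S (s !))) ⟩
  (+ K) / D + (+ (S * (R * K₀))) / D                         ≡⟨ m/d+m′/d≡[m+m′]/d K (S * (R * K₀)) D ⟩
  (+ (K ℕ+ S * (R * K₀))) / D                                ≡⟨ cong (λ t → (+ t) / D) eq ⟩
  (+ (S * K₁ ℕ+ R * K₂ ℕ+ c)) / D                            ≡⟨ m/d+m′/d≡[m+m′]/d (S * K₁ ℕ+ R * K₂) c D ⟨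
  (+ (S * K₁ ℕ+ R * K₂)) / D + (+ c) / D
    ≡⟨ cong (_+ (+ c) / D) (m/d+m′/d≡[m+m′]/d (S * K₁) (R * K₂) D) ⟨
  ((+ (S * K₁)) / D + (+ (R * K₂)) / D) + (+ c) / D
    ≡⟨ cong₂ (λ u v → (u + v) + (+ c) / D) (m/d≡m′/d′ K₁ (R ! * s !) (S * K₁) D (cross₁ K₁ R (r !) S (s !)))
                                           (m/d≡m′/d′ K₂ (r ! * S !) (R * K₂) D (cross₂ K₂ R (r !) S (s !))) ⟨
  ((+ K₁) / (R ! * s !) + (+ K₂) / (r ! * S !)) + (+ c) / D ∎
  where
  open ≡-Reasoning
  open ℕ-Solver.+-*-Solver using (solve; _:*_; _:=_)
  R = suc r
  S = suc s
  D = R ! * S !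
  instance
    _ : NonZero D
    _ = R !* S !≢0
    _ : NonZero (R ! * s !)
    _ = R !* s !≢0
    _ : NonZero (r ! * S !)
    _ = r !* S !≢0
    _ : NonZero (r ! * s !)
    _ = r !* s !≢0
  cross₀ : ∀ K₀ R r! S s! → K₀ * ((R * r!) * (S * s!)) ≡ (S * (R * K₀)) * (r! * s!)
  cross₀ = solve 5 (λ K₀ R r! S s! → K₀ :* ((R :* r!) :* (S :* s!)) := (S :* (R :* K₀)) :* (r! :* s!)) refl
  cross₁ : ∀ K₁ R r! S s! → K₁ * ((R * r!) * (S * s!)) ≡ (S * K₁) * ((R * r!) * s!)
  cross₁ = solve 5 (λ K₁ R r! S s! → K₁ :* ((R :* r!) :* (S :* s!)) := (S :* K₁) :* ((R :* r!) :* s!)) refl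
  cross₂ : ∀ K₂ R r! S s! → K₂ * ((R * r!) * (S * s!)) ≡ (R * K₂) * (r! * (S * s!))
  cross₂ = solve 5 (λ K₂ R r! S s! → K₂ :* ((R :* r!) :* (S :* s!)) := (R :* K₂) :* (r! :* (S :* s!))) refl

a-recurrence : ∀ r s {K K₁ K₂ K₀ c} →
  K ℕ+ suc s * (suc r * K₀) ≡ suc s * K₁ ℕ+ suc r * K₂ ℕ+ c →
  ((+ K) / (suc r ! * suc s !)) {{suc r !* suc s !≢0}} - 1ℚ
    ≡ ((((+ K₁) / (suc r ! * s !)) {{suc r !* s !≢0}} - 1ℚ + (((+ K₂) / (r ! * suc s !)) {{r !* suc s !≢0}} - 1ℚ))
        - (((+ K₀) / (r ! * s !)) {{r !* s !≢0}} - 1ℚ))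
      + ((+ c) / (suc r ! * suc s !)) {{suc r !* suc s !≢0}}
a-recurrence r s {K} {K₁} {K₂} {K₀} {c} eq = begin
  X - 1ℚ                       ≡⟨ solve 2 (λ x x₀ → x :- con 1ℚ := ((x :+ x₀) :- x₀) :- con 1ℚ) refl X X₀ ⟩
  ((X + X₀) - X₀) - 1ℚ         ≡⟨ cong (λ t → (t - X₀) - 1ℚ) (common-denominator-sum r s {K} {K₁} {K₂} {K₀} {c} eq) ⟩
  (((X₁ + X₂) + Xc) - X₀) - 1ℚ ≡⟨ solve 4 (λ x₁ x₂ xc x₀ → (((x₁ :+ x₂) :+ xc) :- x₀) :- con 1ℚ
                                             := (((x₁ :- con 1ℚ) :+ (x₂ :- con 1ℚ)) :- (x₀ :- con 1ℚ)) :+ xc)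
                                         refl X₁ X₂ Xc X₀ ⟩
  (((X₁ - 1ℚ) + (X₂ - 1ℚ)) - (X₀ - 1ℚ)) + Xc ∎
  where
  open ≡-Reasoning
  open ℚ-Solver.+-*-Solver using (solve; _:+_; _:-_; _:=_; con)
  X  = ((+ K) / (suc r ! * suc s !)) {{suc r !* suc s !≢0}}
  X₁ = ((+ K₁) / (suc r ! * s !)) {{suc r !* s !≢0}}
  X₂ = ((+ K₂) / (r ! * suc s !)) {{r !* suc s !≢0}}
  X₀ = ((+ K₀) / (r ! * s !)) {{r !* s !≢0}}
  Xc = ((+ c) / (suc r ! * suc s !)) {{suc r !* suc s !≢0}}

lemma3p1 : ((r : ℕ) → a r 0 ≡ 0ℚ) × ((s : ℕ) → a 0 s ≡ 0ℚ)
    × ((r' s' : ℕ) →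
        a (suc r') (suc s')
          ≡ ((a (suc r') s' + a r' (suc s')) - a r' s')
            + ((+ ((r' ℕ+ s') C r')) / (suc r' ! * suc s' !)) {{suc r' !* suc s' !≢0}})
lemma3p1 =
  (λ r → a-boundary {{r !* 0 !≢0}} (trans (k-boundaryʳ r) (sym (*-identityʳ (r !))))) ,
  (λ s → a-boundary {{0 !* s !≢0}} (trans (k-boundaryˡ s) (sym (*-identityˡ (s !))))) ,
  (λ r s → a-recurrence r s {k (suc r) (suc r ℕ+ suc s)} {k (suc r) (suc r ℕ+ s)} {k r (r ℕ+ suc s)} {k r (r ℕ+ s)}
                         (k-recurrence r s))
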